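{- Let $r\ge 1$ and $q\ge 1$ be integers, and let $p\ge 1$ be the smallest integer for which $H_q(\mathrm{VR}(Q_p;r))\neq 0$. For integers $m\ge 1$ let \[ \mathcal{R}_m = \mathrm{rank}\Big(H_q(\mathrm{VR}(Q_m;r)) \big/ \mathrm{im}\,(\Psi_{m-1,m})_*\Big). \] Then for all integers $n \ge m \ge p$, \[ \mathrm{rank}\Big(H_q(\mathrm{VR}(Q_n;r)) \big/ \mathrm{im}\,(\Psi_{m-1,n})_*\Big) \;\ge\; \sum_{i=m}^{n} 2^{\,i-m}\binom{i-1}{m-1}\cdot \mathcal{R}_m . \]
   Context: $Q_n$ denotes the set $\{0,1\}^n$ with the $\ell^1$ (Hamming) metric. For a metric space $X$ and $r\ge0$, $\mathrm{VR}(X;r)$ is the simplicial complex on vertex set $X$ whose simplices are finite subsets of diameter at most $r$. A (coordinate) subcube of $Q_n$ of dimension $m$ is a subset obtained by choosing a set $S\subseteq[n]$ of $m$ coordinates and a fixed value $b\in\{0,1\}^{[n]\setminus S}$ for the remaining coordinates, i.e. $\{x\in Q_n : x_i=b_i \text{ for } i\notin S\}$; it is isometric to $Q_m$ (identified via the order-preserving bijection of coordinates). There are $2^{n-m}\binom{n}{m}$ such subcubes. For $m<n$ (and also $m\le n$ with the obvious meaning), $\Psi_{m,n}\colon \coprod_{2^{n-m}\binom nm} Q_m \to Q_n$ is the map given by the natural inclusions of all $m$-dimensional subcubes, and $(\Psi_{m,n})_*\colon \bigoplus_{2^{n-m}\binom nm} H_q(\mathrm{VR}(Q_m;r))\to H_q(\mathrm{VR}(Q_n;r))$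 is the induced map on homology. Homology has coefficients in $\mathbb{Z}$ or a field; rank is the cardinality of a maximal linearly independent subset. -}

module Defs where

open import Level using (Level; _⊔_; Setω)
open import Data.Bool using (Bool; true; false; _∧_; if_then_else_)
open import Data.Nat using (ℕ; zero; suc; _∸_; _^_; _≤_; _<_)
import Data.Nat as ℕ
open import Data.Nat.Combinatorics using (_C_)
open import Data.Fin using (Fin; zero; suc)
open import Data.Vec using (Vec; []; _∷_; insertAt; map)
open import Data.List using (List; []; _∷_; _++_)
import Data.List as L
open import Data.List.Relation.Unary.All using (All)
open import Data.Product using (Σ; _×_; _,_; ∃)
open import Relation.Nullary using (¬_)
open import Relation.Binary.PropositionalEquality using (_≡_)
open import Algebra.Bundles using (CommutativeRing)

Q : ℕ → Set
Q n = Vec Bool n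

dist : ∀ {n} → Q n → Q n → ℕ
dist []          []          = 0
dist (true ∷ x)  (true ∷ y)  = dist x y
dist (false ∷ x) (false ∷ y) = dist x y
dist (true ∷ x)  (false ∷ y) = suc (dist x y)
dist (false ∷ x) (true ∷ y)  = suc (dist x y)

allQ : (n : ℕ) → List (Q n)
allQ zero    = [] ∷ []
allQ (suc n) = L.map (false ∷_) (allQ n) ++ L.map (true ∷_) (allQ n)

-- strict lexicographic order on Q_n (false < true); used only to pick a
-- canonical orientation (vertex ordering) of each simplex
data _<Q_ : ∀ {n} → Q n → Q n → Set where
  here : ∀ {n} {x y : Q n} → (false ∷ x) <Q (true ∷ y)
  there : ∀ {n} {b} {x y : Q n} → x <Q y → (b ∷ x) <Q (b ∷ y)

data Increasing {n : ℕ} : ∀ {k} → Vec (Q n) k → Set where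
  []  : Increasing []
  [_] : ∀ x → Increasing (x ∷ [])
  _∷_ : ∀ {k x y} {xs : Vec (Q n) k} → x <Q y → Increasing (y ∷ xs) →
        Increasing (x ∷ y ∷ xs)

AllV : ∀ {a} {A : Set} {k} → (A → Set a) → Vec A k → Set a
AllV P []       = Level.Lift _ Data.Unit.⊤
  where import Data.Unit
AllV P (x ∷ xs) = P x × AllV P xs

DiamLe : ∀ {n k} → ℕ → Vec (Q n) k → Set
DiamLe r σ = AllV (λ x → AllV (λ y → dist x y ≤ r) σ) σ

IsSimplex : ∀ {n k} → ℕ → Vec (Q n) k → Set
IsSimplex r σ = Increasing σ × DiamLe r σ

-- A k-dimensional subcube of Q_n is given by
-- choosing, for every coordinate, either "free" or a fixed bit, with
-- exactly k free coordinates.  There are 2^(n-k) (n choose k) of them.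

data Subcube : ℕ → ℕ → Set where
  []    : Subcube 0 0
  free  : ∀ {n k} → Subcube n k → Subcube (suc n) (suc k)
  fixed : ∀ {n k} → Bool → Subcube n k → Subcube (suc n) k

embed : ∀ {n k} → Subcube n k → Q k → Q n
embed []          []      = []
embed (free s)    (b ∷ x) = b ∷ embed s x
embed (fixed b s) x       = b ∷ embed s x

project : ∀ {n k} → Subcube n k → Q n → Q k
project []          []      = []
project (free s)    (b ∷ x) = b ∷ project s x
project (fixed _ s) (_ ∷ x) = project s x

_==B_ : Bool → Bool → Bool
true  ==B true  = true
false ==B false = true
_     ==B _     = false

inSub : ∀ {n k} → Subcube n k → Q n → Bool
inSub []          []      = true
inSub (free s)    (_ ∷ x) = inSub s x
inSub (fixed b s) (c ∷ x) = (b ==B c) ∧ inSub s x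

allInSub : ∀ {n k j} → Subcube n k → Vec (Q n) j → Bool
allInSub s []       = true
allInSub s (x ∷ xs) = inSub s x ∧ allInSub s xs

-- sum_{i=a}^{b} f i  (empty if b < a)

sumFrom : ℕ → ℕ → (ℕ → ℕ) → ℕ
sumFrom a b f = go (suc b ∸ a)
  where
  go : ℕ → ℕ
  go zero    = 0
  go (suc t) = f (a ℕ.+ t) ℕ.+ go t

-- A q-chain is a function assigning a coefficient to every
-- (q+1)-tuple of vertices, required to vanish on tuples that are not
-- simplices written in increasing order (so chains = free R-module on the
-- q-simplices, each with its increasing orientation).

module Homology {c ℓ} (R : CommutativeRing c ℓ) where
  open CommutativeRing R using (Carrier; _≈_; _+_; _*_; -_; 0#; 1#)

  Chain : ℕ → ℕ → Set c
  Chain n q = Vec (Q n) (suc q) → Carrier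

  IsChain : ∀ {n q} → ℕ → Chain n q → Set ℓ
  IsChain r x = ∀ σ → ¬ IsSimplex r σ → x σ ≈ 0#

  sumL : List Carrier → Carrier
  sumL = L.foldr _+_ 0#

  sumFin : ∀ {k} → (Fin k → Carrier) → Carrier
  sumFin {zero}  f = 0#
  sumFin {suc k} f = f zero + sumFin (λ i → f (suc i))

  sgn : ∀ {k} → Fin k → Carrier
  sgn zero    = 1#
  sgn (suc j) = - sgn j

  ∂ : ∀ {n q} → Chain n (suc q) → Chain n q
  ∂ {n} x σ = sumL (L.map (λ v → sumFin (λ j → sgn j * x (insertAt σ j v))) (allQ n))

  IsCycle : ∀ {n q} → ℕ → Chain n q → Set ℓ
  IsCycle {q = zero}  r x = IsChain r x
  IsCycle {q = suc q} r x = IsChain r x × (∀ σ → ∂ x σ ≈ 0#)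

  IsBoundary : ∀ {n q} → ℕ → Chain n q → Set (c ⊔ ℓ)
  IsBoundary {n} {q} r x =
    Σ (Chain n (suc q)) λ b → IsChain r b × (∀ σ → x σ ≈ ∂ b σ)

  HNonzero : ℕ → ℕ → ℕ → Set (c ⊔ ℓ)
  HNonzero r q n = Σ (Chain n q) λ z → IsCycle r z × ¬ IsBoundary r z

  HZero : ℕ → ℕ → ℕ → Set (c ⊔ ℓ)
  HZero r q n = ∀ (z : Chain n q) → IsCycle r z → IsBoundary r z

  push : ∀ {n k q} → Subcube n k → Chain k q → Chain n q
  push s y σ = if allInSub s σ then y (map (project s) σ) else 0#

  -- a family of (q-cycles on k-subcubes), and the sum of their pushforwards;
  -- the classes of such sums form the image of (Ψ_{k,n})_*
  SubcubeCycles : ℕ → ℕ → ℕ → ℕ → Set (c ⊔ ℓ)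
  SubcubeCycles r q n k =
    Σ (List (Σ (Subcube n k) λ _ → Chain k q)) (All (λ sy → IsCycle r (Data.Product.proj₂ sy)))

  sumPush : ∀ {n k q} → List (Σ (Subcube n k) λ _ → Chain k q) → Chain n q
  sumPush []             σ = 0#
  sumPush ((s , y) ∷ ys) σ = push s y σ + sumPush ys σ

  -- a q-chain x of Q_n is zero in H_q(VR(Q_n;r)) / im (Ψ_{k,n})_* :
  -- x = ∂b + (sum of pushforwards of q-cycles of k-subcubes)
  ZeroInQuot : ∀ {n q} → ℕ → ℕ → Chain n q → Set (c ⊔ ℓ)
  ZeroInQuot {n} {q} r k x =
    Σ (Chain n (suc q)) λ b → IsChain r b ×
    Σ (SubcubeCycles r q n k) λ ys →
      ∀ σ → x σ ≈ ∂ b σ + sumPush (Data.Product.proj₁ ys) σ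

  lincomb : ∀ {n q N} → (Fin N → Carrier) → (Fin N → Chain n q) → Chain n q
  lincomb a z σ = sumFin (λ i → a i * z i σ)

  -- rank (H_q(VR(Q_n;r)) / im (Ψ_{k,n})_*) ≥ N : there are N classes
  -- (represented by q-cycles) that are linearly independent over R
  RankAtLeast : ℕ → ℕ → ℕ → ℕ → ℕ → Set (c ⊔ ℓ)
  RankAtLeast r q n k N =
    Σ (Fin N → Chain n q) λ z → (∀ i → IsCycle r (z i)) ×
      (∀ (a : Fin N → Carrier) → ZeroInQuot r k (lincomb a z) → ∀ i → a i ≈ 0#)

  -- rank (H_q(VR(Q_n;r)) / im (Ψ_{k,n})_*) = N (maximal size of an
  -- independent subset)
  HasRank : ℕ → ℕ → ℕ → ℕ → ℕ → Set (c ⊔ ℓ)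
  HasRank r q n k N = RankAtLeast r q n k N × ¬ RankAtLeast r q n k (suc N)

  Theorem : Set (c ⊔ ℓ)
  Theorem =
    ∀ (r q p : ℕ) → 1 ≤ r → 1 ≤ q → 1 ≤ p →
    HNonzero r q p → (∀ p' → 1 ≤ p' → p' < p → HZero r q p') →
    ∀ (m n : ℕ) → p ≤ m → m ≤ n →
    ∀ (Rm : ℕ) → HasRank r q m (m ∸ 1) Rm →
    RankAtLeast r q n (m ∸ 1)
      (sumFrom m n (λ i → 2 ^ (i ∸ m) ℕ.* ((i ∸ 1) C (m ∸ 1))) ℕ.* Rm)

record IsFieldRing {c ℓ} (R : CommutativeRing c ℓ) : Set (c ⊔ ℓ) where
  open CommutativeRing R using (Carrier; _≈_; _+_; _*_; -_; 0#; 1#)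
  field
    nontrivial : ¬ (1# ≈ 0#)
    inverse    : ∀ x → ¬ (x ≈ 0#) → Σ Carrier λ y → x * y ≈ 1#

record BothCases (Zring : CommutativeRing Level.0ℓ Level.0ℓ) : Setω where
  field
    fieldCoefficients : ∀ {c ℓ} (F : CommutativeRing c ℓ) → IsFieldRing F → Homology.Theorem F
    integerCoefficients : Homology.Theorem Zring

module Submission where

-- Every non-expanding map h : Q_a → Q_b induces a chain map h_*
-- (extend alternatingly, push tuples forward, restrict to increasing tuples),
-- and if h sends every k-subcube into a k-subcube then h_* descends to the
-- quotients by im Ψ_k.
--
-- Let k = m - 1 and write Q_{1+n} = {0,1} × Q_n. Given R = R_m cycles of Q_m
-- independent modulo im Ψ_k, push each of them into the m-subcube {0,1} × t
-- for every k-subcube t of Q_n, and push the independent classes already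
-- found for Q_n into the face {0} × Q_n. The test map of t,
-- (b, x) ↦ (b ∧ [x ∈ t], π_t x), retracts {0,1} × t onto Q_m and flattens
-- every other {0,1} × t', the face {0} × Q_n and every k-subcube into
-- k-subcubes; dropping the first coordinate retracts the face onto Q_n and
-- flattens every {0,1} × t onto t. Hence all these classes are independent,
-- so rank_{1+n} ≥ 2^(n-k) C(n,k) R + rank_n, which sums to the bound.

open import Defs
open import Data.Integer.Properties using (+-*-commutativeRing)

open import Level using (_⊔_)
open import Function using (_∘_; id)
open import Data.Empty using (⊥; ⊥-elim)
open import Data.Unit using (⊤; tt)
open import Data.Bool using (Bool; true; false; _∧_; if_then_else_)
import Data.Bool.Properties as Bool
open import Data.Bool.Properties using (∧-conicalˡ; ∧-conicalʳ; ∧-zeroʳ; ∧-identityʳ)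
open import Data.Nat using (ℕ; zero; suc; _∸_; _^_; _≤_; _<_; z≤n; s≤s)
import Data.Nat as ℕ
import Data.Nat.Properties as ℕP
open import Data.Nat.Combinatorics using (_C_; k>n⇒nCk≡0; nCk+nC[k+1]≡[n+1]C[k+1])
open import Data.Fin using (Fin; zero; suc; _↑ˡ_; _↑ʳ_; splitAt)
open import Data.Fin.Properties using (splitAt⁻¹-↑ˡ; splitAt⁻¹-↑ʳ)
open import Data.Product using (Σ; _×_; _,_; proj₁; proj₂; uncurry)
open import Data.Sum using (inj₁; inj₂)
open import Data.Maybe using (Maybe; nothing; just)
open import Data.Vec using (Vec; []; _∷_; insertAt; map; tail)
import Data.Vec.Properties as VP
open import Data.Vec.Relation.Unary.Any using (here; there)
open import Data.Vec.Membership.Propositional using () renaming (_∈_ to _∈ᵛ_)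
open import Data.Vec.Functional using () renaming (_++_ to _++ᶠ_)
open import Data.Vec.Functional.Properties using (lookup-++ˡ; lookup-++ʳ)
open import Data.List using (List; []; _∷_; _++_; length)
import Data.List as L
import Data.List.Properties as LP
open import Data.List.Relation.Unary.All using (All; []; _∷_)
import Data.List.Relation.Unary.All as All
import Data.List.Relation.Unary.All.Properties as All
open import Data.List.Relation.Unary.Any using (here; there)
open import Data.List.Relation.Unary.AllPairs using ([]; _∷_)
open import Data.List.Relation.Unary.Unique.Propositional using (Unique)
import Data.List.Relation.Unary.Unique.Propositional.Properties as Unique
open import Data.List.Relation.Binary.Disjoint.Propositional using (Disjoint)
open import Data.List.Membership.Propositional using (_∈_)
open import Data.List.Membership.Propositional.Properties using (∈-map⁻; ∈-++⁻)
open import Relation.Nullary using (¬_; Dec; yes; no; does)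
open import Relation.Nullary.Decidable using (_×-dec_; map′)
open import Relation.Binary.Definitions using (Trichotomous; Tri; tri<; tri≈; tri>)
open import Relation.Binary.Consequences using (tri⇒dec<)
open import Relation.Binary.PropositionalEquality as P using (_≡_; _≢_)
open import Algebra.Bundles using (CommutativeRing; CommutativeMonoid)
open import Algebra.Properties.CommutativeSemigroup ℕP.+-commutativeSemigroup using (x∙yz≈y∙xz; xy∙z≈x∙zy)
open import Algebra.Properties.CommutativeSemigroup (CommutativeMonoid.commutativeSemigroup Bool.∧-commutativeMonoid)
  using () renaming (x∙yz≈y∙xz to ∧-x∙yz≈y∙xz; interchange to ∧-interchange)

-- The Hamming cube and non-expanding maps

bitDist : Bool → Bool → ℕ
bitDist true  true  = 0
bitDist false false = 0
bitDist true  false = 1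
bitDist false true  = 1

bitDist-self : ∀ a → bitDist a a ≡ 0
bitDist-self true  = P.refl
bitDist-self false = P.refl

bitDist≤1 : ∀ a b → bitDist a b ≤ 1
bitDist≤1 true  true  = z≤n
bitDist≤1 false false = z≤n
bitDist≤1 true  false = s≤s z≤n
bitDist≤1 false true  = s≤s z≤n

bitDist-∧ : ∀ b c i j → bitDist (b ∧ i) (c ∧ j) ≤ bitDist b c ℕ.+ bitDist i j
bitDist-∧ true  true  i j = ℕP.≤-refl
bitDist-∧ true  false i j = ℕP.≤-trans (bitDist≤1 i false) (ℕP.m≤m+n 1 _)
bitDist-∧ false true  i j = ℕP.≤-trans (bitDist≤1 false j) (ℕP.m≤m+n 1 _)
bitDist-∧ false false i j = z≤n

bitDist-==B : ∀ c a b → bitDist (c ==B a) (c ==B b) ≡ bitDist a b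
bitDist-==B true  true  true  = P.refl
bitDist-==B true  true  false = P.refl
bitDist-==B true  false true  = P.refl
bitDist-==B true  false false = P.refl
bitDist-==B false true  true  = P.refl
bitDist-==B false true  false = P.refl
bitDist-==B false false true  = P.refl
bitDist-==B false false false = P.refl

bitDist-==B-∧ : ∀ c a b i j → bitDist ((c ==B a) ∧ i) ((c ==B b) ∧ j) ≤ bitDist a b ℕ.+ bitDist i j
bitDist-==B-∧ c a b i j =
  P.subst (λ e → bitDist ((c ==B a) ∧ i) ((c ==B b) ∧ j) ≤ e ℕ.+ bitDist i j)
          (bitDist-==B c a b) (bitDist-∧ (c ==B a) (c ==B b) i j)

dist-∷ : ∀ {n} a b (x y : Q n) → dist (a ∷ x) (b ∷ y) ≡ bitDist a b ℕ.+ dist x y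
dist-∷ true  true  x y = P.refl
dist-∷ true  false x y = P.refl
dist-∷ false true  x y = P.refl
dist-∷ false false x y = P.refl

NonExpanding : ∀ {a b} → (Q a → Q b) → Set
NonExpanding h = ∀ x y → dist (h x) (h y) ≤ dist x y

∘-nonExpanding : ∀ {a b d} {h : Q b → Q d} {g : Q a → Q b} →
                 NonExpanding h → NonExpanding g → NonExpanding (h ∘ g)
∘-nonExpanding {g = g} h-ne g-ne x y = ℕP.≤-trans (h-ne (g x) (g y)) (g-ne x y)

-- Strengthened by the membership term, which testMap-nonExpanding needs.
project-dist : ∀ {n k} (t : Subcube n k) (x y : Q n) →
               dist (project t x) (project t y) ℕ.+ bitDist (inSub t x) (inSub t y) ≤ dist x y
project-dist []          []      []      = z≤n
project-dist (free t)    (a ∷ x) (b ∷ y)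
  rewrite dist-∷ a b (project t x) (project t y) | dist-∷ a b x y
        | ℕP.+-assoc (bitDist a b) (dist (project t x) (project t y)) (bitDist (inSub t x) (inSub t y))
  = ℕP.+-monoʳ-≤ (bitDist a b) (project-dist t x y)
project-dist (fixed c t) (a ∷ x) (b ∷ y) rewrite dist-∷ a b x y = begin
  D ℕ.+ bitDist ((c ==B a) ∧ inSub t x) ((c ==B b) ∧ inSub t y)
    ≤⟨ ℕP.+-monoʳ-≤ D (bitDist-==B-∧ c a b (inSub t x) (inSub t y)) ⟩
  D ℕ.+ (bitDist a b ℕ.+ bitDist (inSub t x) (inSub t y))
    ≡⟨ x∙yz≈y∙xz D (bitDist a b) _ ⟩
  bitDist a b ℕ.+ (D ℕ.+ bitDist (inSub t x) (inSub t y))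
    ≤⟨ ℕP.+-monoʳ-≤ (bitDist a b) (project-dist t x y) ⟩
  bitDist a b ℕ.+ dist x y ∎
  where
  open ℕP.≤-Reasoning
  D = dist (project t x) (project t y)

project-nonExpanding : ∀ {n k} (t : Subcube n k) → NonExpanding (project t)
project-nonExpanding t x y = ℕP.≤-trans (ℕP.m≤m+n _ _) (project-dist t x y)

embed-dist : ∀ {n k} (s : Subcube n k) (x y : Q k) → dist (embed s x) (embed s y) ≡ dist x y
embed-dist []          []      []      = P.refl
embed-dist (free s)    (a ∷ x) (b ∷ y) rewrite dist-∷ a b (embed s x) (embed s y) | dist-∷ a b x y =
  P.cong (bitDist a b ℕ.+_) (embed-dist s x y)
embed-dist (fixed c s) x       y       rewrite dist-∷ c c (embed s x) (embed s y) | bitDist-self c =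
  embed-dist s x y

embed-nonExpanding : ∀ {n k} (s : Subcube n k) → NonExpanding (embed s)
embed-nonExpanding s x y = ℕP.≤-reflexive (embed-dist s x y)

tail-nonExpanding : ∀ {n} → NonExpanding (tail {n = n})
tail-nonExpanding (a ∷ x) (b ∷ y) rewrite dist-∷ a b x y = ℕP.m≤n+m _ _

-- Retracts the subcube free t of Q_{1+n} onto Q_{1+k}; the first coordinate
-- records membership in t.
testMap : ∀ {n k} → Subcube n k → Q (suc n) → Q (suc k)
testMap t (b ∷ x) = (b ∧ inSub t x) ∷ project t x

testMap-nonExpanding : ∀ {n k} (t : Subcube n k) → NonExpanding (testMap t)
testMap-nonExpanding t (b ∷ x) (c ∷ y) rewrite dist-∷ b c x y = begin
  dist ((b ∧ inSub t x) ∷ project t x) ((c ∧ inSub t y) ∷ project t y)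
    ≡⟨ dist-∷ (b ∧ inSub t x) (c ∧ inSub t y) _ _ ⟩
  bitDist (b ∧ inSub t x) (c ∧ inSub t y) ℕ.+ D
    ≤⟨ ℕP.+-monoˡ-≤ D (bitDist-∧ b c (inSub t x) (inSub t y)) ⟩
  (bitDist b c ℕ.+ bitDist (inSub t x) (inSub t y)) ℕ.+ D
    ≡⟨ xy∙z≈x∙zy (bitDist b c) _ D ⟩
  bitDist b c ℕ.+ (D ℕ.+ bitDist (inSub t x) (inSub t y))
    ≤⟨ ℕP.+-monoʳ-≤ (bitDist b c) (project-dist t x y) ⟩
  bitDist b c ℕ.+ dist x y ∎
  where
  open ℕP.≤-Reasoning
  D = dist (project t x) (project t y)

<Q-irrefl : ∀ {n} {x : Q n} → ¬ (x <Q x)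
<Q-irrefl (there p) = <Q-irrefl p

<Q-trans : ∀ {n} {x y z : Q n} → x <Q y → y <Q z → x <Q z
<Q-trans here      (there q) = here
<Q-trans (there p) here      = here
<Q-trans (there p) (there q) = there (<Q-trans p q)

<Q-asym : ∀ {n} {x y : Q n} → x <Q y → ¬ (y <Q x)
<Q-asym p q = <Q-irrefl (<Q-trans p q)

<Q-∷⁻ : ∀ {n b} {x y : Q n} → (b ∷ x) <Q (b ∷ y) → x <Q y
<Q-∷⁻ (there p) = p

<Q-∷-tri : ∀ {n} b {x y : Q n} → Tri (x <Q y) (x ≡ y) (y <Q x) →
           Tri ((b ∷ x) <Q (b ∷ y)) (b ∷ x ≡ b ∷ y) ((b ∷ y) <Q (b ∷ x))
<Q-∷-tri b (tri< p ¬e ¬g) = tri< (there p) (¬e ∘ VP.∷-injectiveʳ) (¬g ∘ <Q-∷⁻)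
<Q-∷-tri b (tri≈ ¬l e ¬g) = tri≈ (¬l ∘ <Q-∷⁻) (P.cong (b ∷_) e) (¬g ∘ <Q-∷⁻)
<Q-∷-tri b (tri> ¬l ¬e g) = tri> (¬l ∘ <Q-∷⁻) (¬e ∘ VP.∷-injectiveʳ) (there g)

<Q-cmp : ∀ {n} → Trichotomous {A = Q n} _≡_ _<Q_
<Q-cmp []          []          = tri≈ (λ ()) P.refl (λ ())
<Q-cmp (false ∷ x) (true ∷ y)  = tri< here (λ ()) (λ ())
<Q-cmp (true ∷ x)  (false ∷ y) = tri> (λ ()) (λ ()) here
<Q-cmp (false ∷ x) (false ∷ y) = <Q-∷-tri false (<Q-cmp x y)
<Q-cmp (true ∷ x)  (true ∷ y)  = <Q-∷-tri true (<Q-cmp x y)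

increasing-tail : ∀ {n k} {v : Q n} {σ : Vec (Q n) k} → Increasing (v ∷ σ) → Increasing σ
increasing-tail [ _ ]   = []
increasing-tail (_ ∷ p) = p

increasing-head< : ∀ {n k} {u w : Q n} {τ : Vec (Q n) k} → Increasing (u ∷ τ) → w ∈ᵛ τ → u <Q w
increasing-head< (p ∷ q) (here P.refl) = p
increasing-head< (p ∷ q) (there m)     = <Q-trans p (increasing-head< q m)

increasing-∷ : ∀ {n k} {u : Q n} {τ : Vec (Q n) k} →
               (∀ {w} → w ∈ᵛ τ → u <Q w) → Increasing τ → Increasing (u ∷ τ)
increasing-∷ {u = u} u<τ []      = [ u ]
increasing-∷ u<τ [ x ]   = u<τ (here P.refl) ∷ [ x ]
increasing-∷ u<τ (p ∷ q) = u<τ (here P.refl) ∷ (p ∷ q)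

increasing-map : ∀ {a b k} (h : Q a → Q b) → (∀ {x y} → x <Q y → h x <Q h y) →
                 {σ : Vec (Q a) k} → Increasing σ → Increasing (map h σ)
increasing-map h mono []      = []
increasing-map h mono [ x ]   = [ h x ]
increasing-map h mono (p ∷ q) = mono p ∷ increasing-map h mono q

insertAt-∈ : ∀ {n k} (ρ : Vec (Q n) k) j v → v ∈ᵛ insertAt ρ j v
insertAt-∈ ρ       zero    v = here P.refl
insertAt-∈ (u ∷ ρ) (suc j) v = there (insertAt-∈ ρ j v)

insertAt-∈⁺ : ∀ {n k} (ρ : Vec (Q n) k) j v {w} → w ∈ᵛ ρ → w ∈ᵛ insertAt ρ j v
insertAt-∈⁺ ρ       zero    v m         = there m
insertAt-∈⁺ (u ∷ ρ) (suc j) v (here e)  = here e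
insertAt-∈⁺ (u ∷ ρ) (suc j) v (there m) = there (insertAt-∈⁺ ρ j v m)

increasing-insertAt⁻ : ∀ {n k} (ρ : Vec (Q n) k) j v → Increasing (insertAt ρ j v) → Increasing ρ
increasing-insertAt⁻ ρ       zero    v p = increasing-tail p
increasing-insertAt⁻ (u ∷ ρ) (suc j) v p =
  increasing-∷ (increasing-head< p ∘ insertAt-∈⁺ ρ j v) (increasing-insertAt⁻ ρ j v (increasing-tail p))

increasing? : ∀ {n k} (τ : Vec (Q n) k) → Dec (Increasing τ)
increasing? []          = yes []
increasing? (v ∷ [])    = yes [ v ]
increasing? (v ∷ u ∷ ρ) =
  map′ (uncurry _∷_) (λ { (p ∷ q) → p , q }) (tri⇒dec< <Q-cmp v u ×-dec increasing? (u ∷ ρ))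

_⊆ᵛ_ : ∀ {n k j} → Vec (Q n) k → Vec (Q n) j → Set
σ ⊆ᵛ τ = ∀ {a} → a ∈ᵛ σ → a ∈ᵛ τ

AllV-∈ : ∀ {n k l} {P : Q n → Set l} {σ : Vec (Q n) k} {a} → AllV P σ → a ∈ᵛ σ → P a
AllV-∈ (p , ps) (here P.refl) = p
AllV-∈ (p , ps) (there a∈σ)   = AllV-∈ ps a∈σ

AllV-∈⁻ : ∀ {n k} {P : Q n → Set} (σ : Vec (Q n) k) → (∀ {a} → a ∈ᵛ σ → P a) → AllV P σ
AllV-∈⁻ []      f = Level.lift tt
AllV-∈⁻ (w ∷ σ) f = f (here P.refl) , AllV-∈⁻ σ (f ∘ there)

AllV-map : ∀ {a b k} {P : Q b → Set} {P' : Q a → Set} (h : Q a → Q b) → (∀ x → P' x → P (h x)) →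
           {σ : Vec (Q a) k} → AllV P' σ → AllV P (map h σ)
AllV-map h f {[]}    _        = Level.lift tt
AllV-map h f {w ∷ σ} (p , ps) = f w p , AllV-map h f ps

DiamLe-⊆ : ∀ {n k j} r {σ : Vec (Q n) k} {τ : Vec (Q n) j} → σ ⊆ᵛ τ → DiamLe r τ → DiamLe r σ
DiamLe-⊆ r {σ} σ⊆τ d = AllV-∈⁻ σ λ a∈σ → AllV-∈⁻ σ λ b∈σ → AllV-∈ (AllV-∈ d (σ⊆τ a∈σ)) (σ⊆τ b∈σ)

DiamLe-map : ∀ {a b k} r (h : Q a → Q b) → NonExpanding h → {σ : Vec (Q a) k} → DiamLe r σ → DiamLe r (map h σ)
DiamLe-map r h h-ne = AllV-map h (λ x → AllV-map h (λ y → ℕP.≤-trans (h-ne x y)))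

-- Subcubes

==B-refl : ∀ a → (a ==B a) ≡ true
==B-refl true  = P.refl
==B-refl false = P.refl

==B-sym : ∀ a b → (a ==B b) ≡ (b ==B a)
==B-sym true  true  = P.refl
==B-sym true  false = P.refl
==B-sym false true  = P.refl
==B-sym false false = P.refl

==B-sound : ∀ {a b} → (a ==B b) ≡ true → a ≡ b
==B-sound {true}  {true}  e = P.refl
==B-sound {false} {false} e = P.refl

_==Q_ : ∀ {n} → Q n → Q n → Bool
[]      ==Q []      = true
(a ∷ x) ==Q (b ∷ y) = (a ==B b) ∧ (x ==Q y)

==Q-sym : ∀ {n} (x y : Q n) → (x ==Q y) ≡ (y ==Q x)
==Q-sym []      []      = P.refl
==Q-sym (a ∷ x) (b ∷ y) rewrite ==B-sym a b | ==Q-sym x y = P.refl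

==Q-sound : ∀ {n} {x y : Q n} → (x ==Q y) ≡ true → x ≡ y
==Q-sound {x = []}    {[]}    e = P.refl
==Q-sound {x = a ∷ x} {b ∷ y} e = P.cong₂ _∷_ (==B-sound (∧-conicalˡ _ _ e)) (==Q-sound (∧-conicalʳ _ _ e))

_==V_ : ∀ {n k} → Vec (Q n) k → Vec (Q n) k → Bool
[]      ==V []      = true
(v ∷ σ) ==V (w ∷ τ) = (v ==Q w) ∧ (σ ==V τ)

==V-sym : ∀ {n k} (σ τ : Vec (Q n) k) → (σ ==V τ) ≡ (τ ==V σ)
==V-sym []      []      = P.refl
==V-sym (v ∷ σ) (w ∷ τ) rewrite ==Q-sym v w | ==V-sym σ τ = P.refl

==V-sound : ∀ {n k} {σ τ : Vec (Q n) k} → (σ ==V τ) ≡ true → σ ≡ τ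
==V-sound {σ = []}    {[]}    e = P.refl
==V-sound {σ = v ∷ σ} {w ∷ τ} e = P.cong₂ _∷_ (==Q-sound (∧-conicalˡ _ _ e)) (==V-sound (∧-conicalʳ _ _ e))

allInSub-head : ∀ {n k j} (s : Subcube n k) w (τ : Vec (Q n) j) → allInSub s (w ∷ τ) ≡ true → inSub s w ≡ true
allInSub-head s w τ = ∧-conicalˡ (inSub s w) _

allInSub-tail : ∀ {n k j} (s : Subcube n k) w (τ : Vec (Q n) j) → allInSub s (w ∷ τ) ≡ true → allInSub s τ ≡ true
allInSub-tail s w τ = ∧-conicalʳ (inSub s w) _

==Q-embed : ∀ {n k} (s : Subcube n k) (x : Q k) (y : Q n) →
            (embed s x ==Q y) ≡ (inSub s y ∧ (x ==Q project s y))
==Q-embed []          []      []      = P.refl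
==Q-embed (free s)    (b ∷ x) (c ∷ y) rewrite ==Q-embed s x y = ∧-x∙yz≈y∙xz (b ==B c) (inSub s y) _
==Q-embed (fixed b s) x       (c ∷ y) rewrite ==Q-embed s x y = P.sym (Bool.∧-assoc (b ==B c) (inSub s y) _)

==V-embed : ∀ {n k j} (s : Subcube n k) (σ : Vec (Q k) j) (τ : Vec (Q n) j) →
            (map (embed s) σ ==V τ) ≡ (allInSub s τ ∧ (σ ==V map (project s) τ))
==V-embed s []      []      = P.refl
==V-embed s (v ∷ σ) (w ∷ τ) rewrite ==Q-embed s v w | ==V-embed s σ τ = ∧-interchange (inSub s w) _ _ _

project-embed : ∀ {n k} (s : Subcube n k) (x : Q k) → project s (embed s x) ≡ x
project-embed []          []      = P.refl
project-embed (free s)    (b ∷ x) = P.cong (b ∷_) (project-embed s x)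
project-embed (fixed b s) x       = project-embed s x

inSub-embed : ∀ {n k} (s : Subcube n k) (x : Q k) → inSub s (embed s x) ≡ true
inSub-embed []          []      = P.refl
inSub-embed (free s)    (b ∷ x) = inSub-embed s x
inSub-embed (fixed b s) x rewrite ==B-refl b = inSub-embed s x

embed-project : ∀ {n k} (s : Subcube n k) (y : Q n) → inSub s y ≡ true → embed s (project s y) ≡ y
embed-project []          []      e = P.refl
embed-project (free s)    (b ∷ y) e = P.cong (b ∷_) (embed-project s y e)
embed-project (fixed b s) (c ∷ y) e =
  P.cong₂ _∷_ (==B-sound (∧-conicalˡ _ _ e)) (embed-project s y (∧-conicalʳ _ _ e))

map-embed-project : ∀ {n k j} (s : Subcube n k) (τ : Vec (Q n) j) → allInSub s τ ≡ true →
                    map (embed s) (map (project s) τ) ≡ τ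
map-embed-project s []      e = P.refl
map-embed-project s (w ∷ τ) e =
  P.cong₂ _∷_ (embed-project s w (allInSub-head s w τ e)) (map-embed-project s τ (allInSub-tail s w τ e))

embed-mono : ∀ {n k} (s : Subcube n k) {x y : Q k} → x <Q y → embed s x <Q embed s y
embed-mono (free s)    here      = here
embed-mono (free s)    (there p) = there (embed-mono s p)
embed-mono (fixed b s) p         = there (embed-mono s p)

project-mono : ∀ {n k} (s : Subcube n k) {x y : Q n} → inSub s x ≡ true → inSub s y ≡ true →
               x <Q y → project s x <Q project s y
project-mono (free s)    x∈s y∈s here      = here
project-mono (free s)    x∈s y∈s (there p) = there (project-mono s x∈s y∈s p)
project-mono (fixed b s) {false ∷ x} {true ∷ y} x∈s y∈s here
  with ==B-sound (∧-conicalˡ (b ==B false) (inSub s x) x∈s) | ==B-sound (∧-conicalˡ (b ==B true) (inSub s y) y∈s)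
... | P.refl | ()
project-mono (fixed b s) x∈s y∈s (there p) =
  project-mono s (∧-conicalʳ _ _ x∈s) (∧-conicalʳ _ _ y∈s) p

increasing-project : ∀ {n k j} (s : Subcube n k) {τ : Vec (Q n) j} → allInSub s τ ≡ true →
                     Increasing τ → Increasing (map (project s) τ)
increasing-project s e []      = []
increasing-project s e [ x ]   = [ project s x ]
increasing-project s {w ∷ u ∷ τ} e (p ∷ q) =
  project-mono s (allInSub-head s w (u ∷ τ) e) (allInSub-head s u τ (allInSub-tail s w (u ∷ τ) e)) p
  ∷ increasing-project s (allInSub-tail s w (u ∷ τ) e) q

allFree : ∀ k → Subcube k k
allFree zero    = []
allFree (suc k) = free (allFree k)

inSub-allFree : ∀ {k} (x : Q k) → inSub (allFree k) x ≡ true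
inSub-allFree []      = P.refl
inSub-allFree (b ∷ x) = inSub-allFree x

embed-allFree : ∀ {k} (x : Q k) → embed (allFree k) x ≡ x
embed-allFree []      = P.refl
embed-allFree (b ∷ x) = P.cong (b ∷_) (embed-allFree x)

bottomFace : ∀ n → Subcube (suc n) n
bottomFace n = fixed false (allFree n)

MapsIntoSubcube : ∀ {a b} (k : ℕ) → (Q a → Q b) → Set
MapsIntoSubcube {b = b} k g = Σ (Subcube b k) λ u → ∀ y → inSub u (g y) ≡ true

PreservesSubcubes : ∀ {a b} (k : ℕ) → (Q a → Q b) → Set
PreservesSubcubes {a} k h = ∀ (w : Subcube a k) → MapsIntoSubcube k (h ∘ embed w)

Facet : ℕ → Set
Facet zero    = ⊥
Facet (suc k) = Subcube (suc k) k

inFacet : ∀ {k} → Facet k → Q k → Bool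
inFacet {suc k} u x = inSub u x

freeFacet : ∀ {k} → Facet k → Facet (suc k)
freeFacet {suc k} u = free u

inSub-freeFacet : ∀ {k} (u : Facet k) b (x : Q k) → inSub (freeFacet u) (b ∷ x) ≡ inFacet u x
inSub-freeFacet {suc k} u b x = P.refl

data _⊑_ : ∀ {n k k'} → Subcube n k → Subcube n k' → Set where
  [] : [] ⊑ []
  free-free   : ∀ {n k k'} {t : Subcube n k} {t' : Subcube n k'} → t ⊑ t' → free t ⊑ free t'
  fixed-free  : ∀ {n k k'} {b} {t : Subcube n k} {t' : Subcube n k'} → t ⊑ t' → fixed b t ⊑ free t'
  fixed-fixed : ∀ {n k k'} {b} {t : Subcube n k} {t' : Subcube n k'} → t ⊑ t' → fixed b t ⊑ fixed b t'

⊑-dim : ∀ {n k k'} {t : Subcube n k} {t' : Subcube n k'} → t ⊑ t' → k ≤ k'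
⊑-dim []              = z≤n
⊑-dim (free-free s)   = s≤s (⊑-dim s)
⊑-dim (fixed-free s)  = ℕP.m≤n⇒m≤1+n (⊑-dim s)
⊑-dim (fixed-fixed s) = ⊑-dim s

⊑-same-dim : ∀ {n k} {t t' : Subcube n k} → t ⊑ t' → t ≡ t'
⊑-same-dim []              = P.refl
⊑-same-dim (free-free s)   = P.cong free (⊑-same-dim s)
⊑-same-dim (fixed-free s)  = ⊥-elim (ℕP.n≮n _ (⊑-dim s))
⊑-same-dim (fixed-fixed s) = P.cong (fixed _) (⊑-same-dim s)

data Position {n k k'} (t : Subcube n k) (t' : Subcube n k') : Set where
  misses : (∀ y → inSub t (embed t' y) ≡ false) → Position t t'
  facet  : (u : Facet k) → (∀ y → inFacet u (project t (embed t' y)) ≡ true) → Position t t'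
  inside : t ⊑ t' → Position t t'

fixed-same : ∀ {n k k'} b {t : Subcube n k} {t' : Subcube n k'} → Position t t' → Position (fixed b t) (fixed b t')
fixed-same b (misses m)  = misses λ y → P.trans (P.cong (_∧ _) (==B-refl b)) (m y)
fixed-same b (facet u f) = facet u f
fixed-same b (inside s)  = inside (fixed-fixed s)

position : ∀ {n k k'} (t : Subcube n k) (t' : Subcube n k') → Position t t'
position []          []           = inside []
position (free t)    (free t')    with position t t'
... | misses m  = misses λ { (b ∷ y) → m y }
... | facet u f = facet (freeFacet u) λ { (b ∷ y) → P.trans (inSub-freeFacet u b _) (f y) }
... | inside s  = inside (free-free s)
position {k = suc k} (free t) (fixed c t') =
  facet (fixed c (allFree k)) λ y → P.trans (P.cong (_∧ _) (==B-refl c)) (inSub-allFree (project t (embed t' y)))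
position (fixed b t) (free t')    with position t t'
... | misses m  = misses λ { (c ∷ y) → P.trans (P.cong ((b ==B c) ∧_) (m y)) (∧-zeroʳ _) }
... | facet u f = facet u λ { (c ∷ y) → f y }
... | inside s  = inside (fixed-free s)
position (fixed true t)  (fixed false t') = misses λ y → P.refl
position (fixed false t) (fixed true t')  = misses λ y → P.refl
position (fixed true t)  (fixed true t')  = fixed-same _ (position t t')
position (fixed false t) (fixed false t') = fixed-same _ (position t t')

testMap-misses : ∀ {n k k'} (t : Subcube n k) (t' : Subcube n k') → (∀ y → inSub t (embed t' y) ≡ false) →
                 ∀ c y → inSub (bottomFace k) (testMap t (c ∷ embed t' y)) ≡ true
testMap-misses t t' m c y =
  P.trans (P.cong (λ d → (false ==B d) ∧ _) (P.trans (P.cong (c ∧_) (m y)) (∧-zeroʳ c)))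
          (inSub-allFree (project t (embed t' y)))

testMap-facet : ∀ {n k k'} (t : Subcube n k) (t' : Subcube n k') (u : Facet k) →
                (∀ y → inFacet u (project t (embed t' y)) ≡ true) →
                ∀ c y → inSub (freeFacet u) (testMap t (c ∷ embed t' y)) ≡ true
testMap-facet t t' u f c y = P.trans (inSub-freeFacet u _ _) (f y)

testMap-flattens : ∀ {n k k'} {t : Subcube n k} {t' : Subcube n k'} → Position t t' → ¬ (t ⊑ t') →
                   MapsIntoSubcube k (testMap t ∘ embed (free t'))
testMap-flattens {t = t} {t'} (misses m)  _ = bottomFace _ , λ { (c ∷ y) → testMap-misses t t' m c y }
testMap-flattens {t = t} {t'} (facet u f) _ = freeFacet u , λ { (c ∷ y) → testMap-facet t t' u f c y }
testMap-flattens (inside s)  t⋢t' = ⊥-elim (t⋢t' s)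

testMap-free : ∀ {n k} (t t' : Subcube n k) → t ≢ t' → MapsIntoSubcube k (testMap t ∘ embed (free t'))
testMap-free t t' t≢t' = testMap-flattens (position t t') (t≢t' ∘ ⊑-same-dim)

testMap-retracts : ∀ {n k} (t : Subcube n k) (y : Q (suc k)) → testMap t (embed (free t) y) ≡ y
testMap-retracts t (c ∷ y) =
  P.cong₂ _∷_ (P.trans (P.cong (c ∧_) (inSub-embed t y)) (∧-identityʳ c)) (project-embed t y)

testMap-bottomFace : ∀ {n k} (t : Subcube n k) → MapsIntoSubcube k (testMap t ∘ embed (bottomFace n))
testMap-bottomFace {n} {k} t = bottomFace k , λ y → inSub-allFree (project t (embed (allFree n) y))

testMap-preservesSubcubes : ∀ {n k} (t : Subcube n k) → PreservesSubcubes k (testMap t)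
testMap-preservesSubcubes t (free t') = testMap-flattens (position t t') (ℕP.n≮n _ ∘ ⊑-dim)
testMap-preservesSubcubes {k = k} t (fixed false t') = bottomFace k , λ y → inSub-allFree (project t (embed t' y))
testMap-preservesSubcubes {k = k} t (fixed true t') with position t t'
... | misses m  = bottomFace k , testMap-misses t t' m true
... | facet u f = freeFacet u , testMap-facet t t' u f true
... | inside s with ⊑-same-dim s
...   | P.refl = fixed true (allFree k) , λ y →
  P.trans (P.cong (λ d → (true ==B d) ∧ inSub (allFree k) (project t (embed t y))) (inSub-embed t y))
          (inSub-allFree (project t (embed t y)))

tail-free : ∀ {n k} (t : Subcube n k) → MapsIntoSubcube k (tail ∘ embed (free t))
tail-free t = t , λ { (c ∷ y) → inSub-embed t y }

embed-enlarge : ∀ {n j} (t : Subcube n j) → j < n → MapsIntoSubcube (suc j) (embed t)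
embed-enlarge (free t)    (s≤s j<n) with embed-enlarge t j<n
... | u , t⊆u = free u , λ { (b ∷ y) → t⊆u y }
embed-enlarge (fixed c t) j<n = free t , inSub-embed t

tail-preservesSubcubes : ∀ {n k} → k ≤ n → PreservesSubcubes k (tail {n = n})
tail-preservesSubcubes k≤n (fixed c t) = t , inSub-embed t
tail-preservesSubcubes k≤n (free t) with embed-enlarge t k≤n
... | u , t⊆u = u , λ { (c ∷ y) → t⊆u y }

-- Enumerating and counting subcubes

bothFixed : ∀ {n k} → List (Subcube n k) → List (Subcube (suc n) k)
bothFixed L = L.map (fixed false) L ++ L.map (fixed true) L

allSub : ∀ n k → List (Subcube n k)
allSub zero    zero    = [] ∷ []
allSub zero    (suc k) = []
allSub (suc n) zero    = bothFixed (allSub n zero)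
allSub (suc n) (suc k) = L.map free (allSub n k) ++ bothFixed (allSub n (suc k))

free-injective : ∀ {n k} {a b : Subcube n k} → free a ≡ free b → a ≡ b
free-injective P.refl = P.refl

fixed-injective : ∀ {n k} {c} {a b : Subcube n k} → fixed c a ≡ fixed c b → a ≡ b
fixed-injective P.refl = P.refl

map-disjoint : ∀ {A B C : Set} (f : A → C) (g : B → C) → (∀ x y → f x ≢ g y) →
               ∀ {xs ys} → Disjoint (L.map f xs) (L.map g ys)
map-disjoint f g f≢g (p , q) with ∈-map⁻ f p | ∈-map⁻ g q
... | x , _ , P.refl | y , _ , e = f≢g x y e

bothFixed-unique : ∀ {n k} {L : List (Subcube n k)} → Unique L → Unique (bothFixed L)
bothFixed-unique u =
  Unique.++⁺ (Unique.map⁺ fixed-injective u) (Unique.map⁺ fixed-injective u)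
             (map-disjoint (fixed false) (fixed true) λ _ _ ())

free-bothFixed-disjoint : ∀ {n k} (L : List (Subcube n k)) {L' : List (Subcube n (suc k))} →
                          Disjoint (L.map free L) (bothFixed L')
free-bothFixed-disjoint L {L'} (p , q) with ∈-++⁻ (L.map (fixed false) L') q
... | inj₁ q' = map-disjoint free (fixed false) (λ _ _ ()) (p , q')
... | inj₂ q' = map-disjoint free (fixed true)  (λ _ _ ()) (p , q')

allSub-unique : ∀ n k → Unique (allSub n k)
allSub-unique zero    zero    = [] ∷ []
allSub-unique zero    (suc k) = []
allSub-unique (suc n) zero    = bothFixed-unique (allSub-unique n zero)
allSub-unique (suc n) (suc k) =
  Unique.++⁺ (Unique.map⁺ free-injective (allSub-unique n k)) (bothFixed-unique (allSub-unique n (suc k)))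
             (free-bothFixed-disjoint (allSub n k) {allSub n (suc k)})

length-bothFixed : ∀ {n k} (L : List (Subcube n k)) → length (bothFixed L) ≡ 2 ℕ.* length L
length-bothFixed L
  rewrite LP.length-++ (L.map (fixed false) L) {L.map (fixed true) L}
        | LP.length-map (fixed false) L | LP.length-map (fixed true) L
  = P.cong (length L ℕ.+_) (P.sym (ℕP.+-identityʳ (length L)))

double-2^[n∸1+k]*nC[1+k] : ∀ n k → 2 ℕ.* (2 ^ (n ∸ suc k) ℕ.* (n C suc k)) ≡ 2 ^ (n ∸ k) ℕ.* (n C suc k)
double-2^[n∸1+k]*nC[1+k] n k with k ℕP.<? n
double-2^[n∸1+k]*nC[1+k] (suc n) k | yes (s≤s k≤n) rewrite ℕP.+-∸-assoc 1 k≤n =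
  P.sym (ℕP.*-assoc 2 (2 ^ (n ∸ k)) _)
... | no k≮n rewrite k>n⇒nCk≡0 (s≤s (ℕP.≮⇒≥ k≮n)) | ℕP.*-zeroʳ (2 ^ (n ∸ suc k)) =
  P.sym (ℕP.*-zeroʳ (2 ^ (n ∸ k)))

length-allSub : ∀ n k → length (allSub n k) ≡ 2 ^ (n ∸ k) ℕ.* (n C k)
length-allSub zero    zero    = P.refl
length-allSub zero    (suc k) = P.refl
length-allSub (suc n) zero    rewrite length-bothFixed (allSub n zero) | length-allSub n zero =
  P.sym (ℕP.*-assoc 2 (2 ^ n) 1)
length-allSub (suc n) (suc k)
  rewrite LP.length-++ (L.map free (allSub n k)) {bothFixed (allSub n (suc k))}
        | LP.length-map free (allSub n k) | length-bothFixed (allSub n (suc k))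
        | length-allSub n k | length-allSub n (suc k)
        | double-2^[n∸1+k]*nC[1+k] n k
        | P.sym (nCk+nC[k+1]≡[n+1]C[k+1] n k)
  = P.sym (ℕP.*-distribˡ-+ (2 ^ (n ∸ k)) (n C k) (n C suc k))

sumFrom-empty : ∀ k f → sumFrom (suc k) k f ≡ 0
sumFrom-empty k f rewrite ℕP.n∸n≡0 k = P.refl

sumFrom-last : ∀ k n f → k ≤ n → sumFrom (suc k) (suc n) f ≡ f (suc n) ℕ.+ sumFrom (suc k) n f
sumFrom-last k n f k≤n rewrite ℕP.+-∸-assoc 1 k≤n =
  P.cong (λ i → f i ℕ.+ sumFrom (suc k) n f) (P.cong suc (ℕP.m+[n∸m]≡n k≤n))

Fin-+-elim : ∀ {p} M {N} {P : Fin (M ℕ.+ N) → Set p} → (∀ i → P (i ↑ˡ N)) → (∀ j → P (M ↑ʳ j)) → ∀ i → P i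
Fin-+-elim M {P = P} left right i with splitAt M i in eq
... | inj₁ i′ = P.subst P (splitAt⁻¹-↑ˡ eq) (left i′)
... | inj₂ j  = P.subst P (splitAt⁻¹-↑ʳ eq) (right j)

++ᶠ-∀ : ∀ {a p} {A : Set a} {P : A → Set p} {M N} {f : Fin M → A} {g : Fin N → A} →
        (∀ i → P (f i)) → (∀ j → P (g j)) → ∀ i → P ((f ++ᶠ g) i)
++ᶠ-∀ {M = M} Pf Pg i with splitAt M i
... | inj₁ i′ = Pf i′
... | inj₂ j  = Pg j

-- Chains with coefficients in a commutative ring

module WithCoefficients {c ℓ} (CR : CommutativeRing c ℓ) where
  open CommutativeRing CR hiding (zero)
  open Homology CR
  open import Algebra.Properties.Ring ring using (-‿distribˡ-*; -‿distribʳ-*; -1*x≈-x)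
  open import Algebra.Properties.AbelianGroup +-abelianGroup
    using () renaming (ε⁻¹≈ε to -0#≈0#; ⁻¹-involutive to -‿involutive; ⁻¹-∙-comm to -‿+-comm)
  open import Algebra.Properties.CommutativeSemigroup +-commutativeSemigroup using (interchange)
  open import Algebra.Properties.CommutativeSemigroup *-commutativeSemigroup
    using () renaming (x∙yz≈y∙xz to *-x∙yz≈y∙xz)
  open import Relation.Binary.Reasoning.Setoid setoid

  ΣL : ∀ {a} {A : Set a} → List A → (A → Carrier) → Carrier
  ΣL xs f = sumL (L.map f xs)

  ΣL-cong : ∀ {a} {A : Set a} (xs : List A) {f g : A → Carrier} → (∀ x → f x ≈ g x) → ΣL xs f ≈ ΣL xs g
  ΣL-cong []       e = refl
  ΣL-cong (x ∷ xs) e = +-cong (e x) (ΣL-cong xs e)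

  ΣL-zero : ∀ {a} {A : Set a} (xs : List A) {f : A → Carrier} → (∀ x → f x ≈ 0#) → ΣL xs f ≈ 0#
  ΣL-zero []       e = refl
  ΣL-zero (x ∷ xs) e = trans (+-cong (e x) (ΣL-zero xs e)) (+-identityʳ 0#)

  ΣL-+ : ∀ {a} {A : Set a} (xs : List A) (f g : A → Carrier) → ΣL xs (λ x → f x + g x) ≈ ΣL xs f + ΣL xs g
  ΣL-+ []       f g = sym (+-identityʳ 0#)
  ΣL-+ (x ∷ xs) f g = trans (+-congˡ (ΣL-+ xs f g)) (interchange (f x) (g x) _ _)

  ΣL-* : ∀ {a} {A : Set a} (xs : List A) (d : Carrier) (f : A → Carrier) → d * ΣL xs f ≈ ΣL xs (λ x → d * f x)
  ΣL-* []       d f = zeroʳ d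
  ΣL-* (x ∷ xs) d f = trans (distribˡ d (f x) _) (+-congˡ (ΣL-* xs d f))

  ΣL-neg : ∀ {a} {A : Set a} (xs : List A) (f : A → Carrier) → - ΣL xs f ≈ ΣL xs (λ x → - f x)
  ΣL-neg []       f = -0#≈0#
  ΣL-neg (x ∷ xs) f = trans (sym (-‿+-comm _ _)) (+-congˡ (ΣL-neg xs f))

  ΣL-++ : ∀ {a} {A : Set a} (xs ys : List A) (f : A → Carrier) → ΣL (xs ++ ys) f ≈ ΣL xs f + ΣL ys f
  ΣL-++ []       ys f = sym (+-identityˡ _)
  ΣL-++ (x ∷ xs) ys f = trans (+-congˡ (ΣL-++ xs ys f)) (sym (+-assoc _ _ _))

  ΣL-map : ∀ {a b} {A : Set a} {B : Set b} (g : A → B) (xs : List A) (f : B → Carrier) →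
           ΣL (L.map g xs) f ≈ ΣL xs (f ∘ g)
  ΣL-map g []       f = refl
  ΣL-map g (x ∷ xs) f = +-congˡ (ΣL-map g xs f)

  ΣL-swap : ∀ {a b} {A : Set a} {B : Set b} (xs : List A) (ys : List B) (f : A → B → Carrier) →
            ΣL xs (λ x → ΣL ys (f x)) ≈ ΣL ys (λ y → ΣL xs (λ x → f x y))
  ΣL-swap []       ys f = sym (ΣL-zero ys (λ _ → refl))
  ΣL-swap (x ∷ xs) ys f = trans (+-congˡ (ΣL-swap xs ys f)) (sym (ΣL-+ ys _ _))

  ΣL²-antisymmetric : ∀ {a} {A : Set a} (xs : List A) (F : A → A → Carrier) →
                      (∀ x y → F x y ≈ - F y x) → (∀ x → F x x ≈ 0#) → ΣL xs (λ x → ΣL xs (F x)) ≈ 0#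
  ΣL²-antisymmetric []        F anti diag = refl
  ΣL²-antisymmetric (x₀ ∷ xs) F anti diag = begin
    (F x₀ x₀ + ΣL xs (F x₀)) + ΣL xs (λ x → F x x₀ + ΣL xs (F x))
      ≈⟨ +-cong (trans (+-congʳ (diag x₀)) (+-identityˡ _)) (ΣL-+ xs _ _) ⟩
    ΣL xs (F x₀) + (ΣL xs (λ x → F x x₀) + ΣL xs (λ x → ΣL xs (F x)))
      ≈⟨ sym (+-assoc _ _ _) ⟩
    (ΣL xs (F x₀) + ΣL xs (λ x → F x x₀)) + ΣL xs (λ x → ΣL xs (F x))
      ≈⟨ +-cong (sym (ΣL-+ xs _ _)) (ΣL²-antisymmetric xs F anti diag) ⟩
    ΣL xs (λ y → F x₀ y + F y x₀) + 0#
      ≈⟨ +-identityʳ _ ⟩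
    ΣL xs (λ y → F x₀ y + F y x₀)
      ≈⟨ ΣL-zero xs (λ y → trans (+-congʳ (anti x₀ y)) (trans (+-comm _ _) (-‿inverseʳ _))) ⟩
    0# ∎

  if-cong : ∀ (b : Bool) {x y : Carrier} → x ≈ y → (if b then x else 0#) ≈ (if b then y else 0#)
  if-cong true  e = e
  if-cong false e = refl

  if-zero : ∀ (b : Bool) {x : Carrier} → x ≈ 0# → (if b then x else 0#) ≈ 0#
  if-zero true  e = e
  if-zero false e = refl

  if-≡ : ∀ {b d : Bool} → b ≡ d → (x : Carrier) → (if b then x else 0#) ≈ (if d then x else 0#)
  if-≡ P.refl x = refl

  if-∧ : ∀ (b d : Bool) (x : Carrier) → (if b ∧ d then x else 0#) ≡ (if b then (if d then x else 0#) else 0#)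
  if-∧ true  d x = P.refl
  if-∧ false d x = P.refl

  if-comm : ∀ (b d : Bool) (x : Carrier) →
            (if b then (if d then x else 0#) else 0#) ≡ (if d then (if b then x else 0#) else 0#)
  if-comm true  d     x = P.refl
  if-comm false true  x = P.refl
  if-comm false false x = P.refl

  if-* : ∀ (b : Bool) (d x : Carrier) → d * (if b then x else 0#) ≈ (if b then d * x else 0#)
  if-* true  d x = refl
  if-* false d x = zeroʳ d

  if-neg : ∀ (b : Bool) (x : Carrier) → - (if b then x else 0#) ≈ (if b then - x else 0#)
  if-neg true  x = refl
  if-neg false x = -0#≈0#

  if-+ : ∀ (b : Bool) (x y : Carrier) → (if b then x + y else 0#) ≈ (if b then x else 0#) + (if b then y else 0#)
  if-+ true  x y = refl
  if-+ false x y = sym (+-identityʳ 0#)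

  ΣL-if : ∀ {a} {A : Set a} (b : Bool) (xs : List A) (f : A → Carrier) →
          (if b then ΣL xs f else 0#) ≈ ΣL xs (λ x → if b then f x else 0#)
  ΣL-if true  xs f = refl
  ΣL-if false xs f = sym (ΣL-zero xs (λ _ → refl))

  ΣL-allQ-suc : ∀ n (F : Q (suc n) → Carrier) →
                ΣL (allQ (suc n)) F ≈ ΣL (allQ n) (F ∘ (false ∷_)) + ΣL (allQ n) (F ∘ (true ∷_))
  ΣL-allQ-suc n F = trans (ΣL-++ (L.map (false ∷_) (allQ n)) _ F) (+-cong (ΣL-map _ (allQ n) F) (ΣL-map _ (allQ n) F))

  allQ-δ : ∀ n (w : Q n) (g : Q n → Carrier) → ΣL (allQ n) (λ v → if v ==Q w then g v else 0#) ≈ g w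
  allQ-δ zero    []          g = +-identityʳ _
  allQ-δ (suc n) (false ∷ w) g =
    trans (ΣL-allQ-suc n _) (trans (+-cong (allQ-δ n w _) (ΣL-zero (allQ n) (λ _ → refl))) (+-identityʳ _))
  allQ-δ (suc n) (true ∷ w)  g =
    trans (ΣL-allQ-suc n _) (trans (+-cong (ΣL-zero (allQ n) (λ _ → refl)) (allQ-δ n w _)) (+-identityˡ _))

  allQ-δ' : ∀ n (w : Q n) (g : Q n → Carrier) → ΣL (allQ n) (λ v → if w ==Q v then g v else 0#) ≈ g w
  allQ-δ' n w g = trans (ΣL-cong (allQ n) (λ v → if-≡ (==Q-sym w v) (g v))) (allQ-δ n w g)

  ΣT : ∀ {n} k → (Vec (Q n) k → Carrier) → Carrier
  ΣT     zero    F = F []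
  ΣT {n} (suc k) F = ΣL (allQ n) (λ v → ΣT k (λ σ → F (v ∷ σ)))

  ΣT-cong : ∀ {n} k {F G : Vec (Q n) k → Carrier} → (∀ σ → F σ ≈ G σ) → ΣT k F ≈ ΣT k G
  ΣT-cong     zero    e = e []
  ΣT-cong {n} (suc k) e = ΣL-cong (allQ n) (λ v → ΣT-cong k (λ σ → e (v ∷ σ)))

  ΣT-zero : ∀ {n} k {F : Vec (Q n) k → Carrier} → (∀ σ → F σ ≈ 0#) → ΣT k F ≈ 0#
  ΣT-zero     zero    e = e []
  ΣT-zero {n} (suc k) e = ΣL-zero (allQ n) (λ v → ΣT-zero k (λ σ → e (v ∷ σ)))

  ΣT-+ : ∀ {n} k (F G : Vec (Q n) k → Carrier) → ΣT k (λ σ → F σ + G σ) ≈ ΣT k F + ΣT k G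
  ΣT-+     zero    F G = refl
  ΣT-+ {n} (suc k) F G = trans (ΣL-cong (allQ n) (λ v → ΣT-+ k _ _)) (ΣL-+ (allQ n) _ _)

  ΣT-* : ∀ {n} k (d : Carrier) (F : Vec (Q n) k → Carrier) → d * ΣT k F ≈ ΣT k (λ σ → d * F σ)
  ΣT-*     zero    d F = refl
  ΣT-* {n} (suc k) d F = trans (ΣL-* (allQ n) d _) (ΣL-cong (allQ n) (λ v → ΣT-* k d _))

  ΣT-neg : ∀ {n} k (F : Vec (Q n) k → Carrier) → - ΣT k F ≈ ΣT k (λ σ → - F σ)
  ΣT-neg     zero    F = refl
  ΣT-neg {n} (suc k) F = trans (ΣL-neg (allQ n) _) (ΣL-cong (allQ n) (λ v → ΣT-neg k _))

  ΣT-if : ∀ {n} k (b : Bool) (F : Vec (Q n) k → Carrier) →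
          (if b then ΣT k F else 0#) ≈ ΣT k (λ σ → if b then F σ else 0#)
  ΣT-if k true  F = refl
  ΣT-if k false F = sym (ΣT-zero k (λ _ → refl))

  ΣT-swapL : ∀ {n a} {A : Set a} k (xs : List A) (F : Vec (Q n) k → A → Carrier) →
             ΣT k (λ σ → ΣL xs (F σ)) ≈ ΣL xs (λ x → ΣT k (λ σ → F σ x))
  ΣT-swapL     zero    xs F = refl
  ΣT-swapL {n} (suc k) xs F = trans (ΣL-cong (allQ n) (λ v → ΣT-swapL k xs _)) (ΣL-swap (allQ n) xs _)

  ΣT-swap : ∀ {n m} k j (F : Vec (Q n) k → Vec (Q m) j → Carrier) →
            ΣT k (λ σ → ΣT j (F σ)) ≈ ΣT j (λ ρ → ΣT k (λ σ → F σ ρ))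
  ΣT-swap         k zero    F = refl
  ΣT-swap {m = m} k (suc j) F = trans (ΣT-swapL k (allQ m) _) (ΣL-cong (allQ m) (λ w → ΣT-swap k j _))

  ΣT-δ : ∀ {n} k (τ : Vec (Q n) k) (f : Vec (Q n) k → Carrier) → ΣT k (λ σ → if σ ==V τ then f σ else 0#) ≈ f τ
  ΣT-δ     zero    []      f = refl
  ΣT-δ {n} (suc k) (w ∷ τ) f = begin
    ΣL (allQ n) (λ v → ΣT k (λ σ → if (v ==Q w) ∧ (σ ==V τ) then f (v ∷ σ) else 0#))
      ≈⟨ ΣL-cong (allQ n) (λ v → ΣT-cong k (λ σ → reflexive (if-∧ (v ==Q w) (σ ==V τ) _))) ⟩
    ΣL (allQ n) (λ v → ΣT k (λ σ → if v ==Q w then (if σ ==V τ then f (v ∷ σ) else 0#) else 0#))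
      ≈⟨ ΣL-cong (allQ n) (λ v → sym (ΣT-if k (v ==Q w) _)) ⟩
    ΣL (allQ n) (λ v → if v ==Q w then ΣT k (λ σ → if σ ==V τ then f (v ∷ σ) else 0#) else 0#)
      ≈⟨ ΣL-cong (allQ n) (λ v → if-cong (v ==Q w) (ΣT-δ k τ (λ σ → f (v ∷ σ)))) ⟩
    ΣL (allQ n) (λ v → if v ==Q w then f (v ∷ τ) else 0#)
      ≈⟨ allQ-δ n w (λ v → f (v ∷ τ)) ⟩
    f (w ∷ τ) ∎

  ΣT-δ' : ∀ {n} k (τ : Vec (Q n) k) (f : Vec (Q n) k → Carrier) → ΣT k (λ σ → if τ ==V σ then f σ else 0#) ≈ f τ
  ΣT-δ' k τ f = trans (ΣT-cong k (λ σ → if-≡ (==V-sym τ σ) (f σ))) (ΣT-δ k τ f)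

  sumFin-cong : ∀ {k} {f g : Fin k → Carrier} → (∀ i → f i ≈ g i) → sumFin f ≈ sumFin g
  sumFin-cong {zero}  e = refl
  sumFin-cong {suc k} e = +-cong (e zero) (sumFin-cong (e ∘ suc))

  sumFin-zero : ∀ {k} {f : Fin k → Carrier} → (∀ i → f i ≈ 0#) → sumFin f ≈ 0#
  sumFin-zero {zero}  e = refl
  sumFin-zero {suc k} e = trans (+-cong (e zero) (sumFin-zero (e ∘ suc))) (+-identityʳ 0#)

  sumFin-neg : ∀ {k} (f : Fin k → Carrier) → - sumFin f ≈ sumFin (λ i → - f i)
  sumFin-neg {zero}  f = -0#≈0#
  sumFin-neg {suc k} f = trans (sym (-‿+-comm _ _)) (+-congˡ (sumFin-neg (f ∘ suc)))

  sumFin-* : ∀ {k} (d : Carrier) (f : Fin k → Carrier) → d * sumFin f ≈ sumFin (λ i → d * f i)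
  sumFin-* {zero}  d f = zeroʳ d
  sumFin-* {suc k} d f = trans (distribˡ d _ _) (+-congˡ (sumFin-* d (f ∘ suc)))

  sumFin-splitAt : ∀ A {B} (f : Fin (A ℕ.+ B) → Carrier) →
                   sumFin f ≈ sumFin (λ i → f (i ↑ˡ B)) + sumFin (λ j → f (A ↑ʳ j))
  sumFin-splitAt zero    f = sym (+-identityˡ _)
  sumFin-splitAt (suc A) f = trans (+-congˡ (sumFin-splitAt A (f ∘ suc))) (sym (+-assoc _ _ _))

  -- Alternating extension

  -- The value at (v ∷ ρ), ρ increasing, of the alternating extension of x:
  -- v is moved to its sorted position, each transposition flipping the sign.
  signedInsert : ∀ {n k} → (Vec (Q n) (suc k) → Carrier) → Q n → Vec (Q n) k → Carrier
  signedInsert x v []      = x (v ∷ [])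
  signedInsert x v (u ∷ ρ) with <Q-cmp v u
  ... | tri< _ _ _ = x (v ∷ u ∷ ρ)
  ... | tri≈ _ _ _ = 0#
  ... | tri> _ _ _ = - signedInsert (x ∘ (u ∷_)) v ρ

  signedInsert-< : ∀ {n k} (x : Vec (Q n) (suc (suc k)) → Carrier) {v u} (ρ : Vec (Q n) k) →
                   v <Q u → signedInsert x v (u ∷ ρ) ≡ x (v ∷ u ∷ ρ)
  signedInsert-< x {v} {u} ρ v<u with <Q-cmp v u
  ... | tri< _   _ _ = P.refl
  ... | tri≈ v≮u _ _ = ⊥-elim (v≮u v<u)
  ... | tri> v≮u _ _ = ⊥-elim (v≮u v<u)

  signedInsert-≡ : ∀ {n k} (x : Vec (Q n) (suc (suc k)) → Carrier) v (ρ : Vec (Q n) k) →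
                   signedInsert x v (v ∷ ρ) ≡ 0#
  signedInsert-≡ x v ρ with <Q-cmp v v
  ... | tri< _ v≢v _ = ⊥-elim (v≢v P.refl)
  ... | tri≈ _ _   _ = P.refl
  ... | tri> _ v≢v _ = ⊥-elim (v≢v P.refl)

  signedInsert-> : ∀ {n k} (x : Vec (Q n) (suc (suc k)) → Carrier) {v u} (ρ : Vec (Q n) k) →
                   u <Q v → signedInsert x v (u ∷ ρ) ≡ - signedInsert (x ∘ (u ∷_)) v ρ
  signedInsert-> x {v} {u} ρ u<v with <Q-cmp v u
  ... | tri< _ _ u≮v = ⊥-elim (u≮v u<v)
  ... | tri≈ _ _ u≮v = ⊥-elim (u≮v u<v)
  ... | tri> _ _ _   = P.refl

  signedInsert-cong : ∀ {n k} {x y : Vec (Q n) (suc k) → Carrier} → (∀ τ → x τ ≈ y τ) →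
                      ∀ v ρ → signedInsert x v ρ ≈ signedInsert y v ρ
  signedInsert-cong e v []      = e (v ∷ [])
  signedInsert-cong e v (u ∷ ρ) with <Q-cmp v u
  ... | tri< _ _ _ = e _
  ... | tri≈ _ _ _ = refl
  ... | tri> _ _ _ = -‿cong (signedInsert-cong (e ∘ (u ∷_)) v ρ)

  signedInsert-∘ : ∀ {n k} (f : Carrier → Carrier) → f 0# ≈ 0# → (∀ a → f (- a) ≈ - f a) →
                   (x : Vec (Q n) (suc k) → Carrier) → ∀ v ρ → signedInsert (f ∘ x) v ρ ≈ f (signedInsert x v ρ)
  signedInsert-∘ f f0 f- x v []      = refl
  signedInsert-∘ f f0 f- x v (u ∷ ρ) with <Q-cmp v u
  ... | tri< _ _ _ = refl
  ... | tri≈ _ _ _ = sym f0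
  ... | tri> _ _ _ = trans (-‿cong (signedInsert-∘ f f0 f- (x ∘ (u ∷_)) v ρ)) (sym (f- _))

  signedInsert-neg : ∀ {n k} (x : Vec (Q n) (suc k) → Carrier) v ρ →
                     signedInsert (λ τ → - x τ) v ρ ≈ - signedInsert x v ρ
  signedInsert-neg = signedInsert-∘ -_ -0#≈0# (λ _ → refl)

  signedInsert-zero : ∀ {n k} {x : Vec (Q n) (suc k) → Carrier} → (∀ τ → x τ ≈ 0#) → ∀ v ρ → signedInsert x v ρ ≈ 0#
  signedInsert-zero {x = x} e v ρ =
    trans (signedInsert-cong e v ρ) (signedInsert-∘ (λ _ → 0#) refl (λ _ → sym -0#≈0#) x v ρ)

  signedInsert-+ : ∀ {n k} (x y : Vec (Q n) (suc k) → Carrier) v ρ →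
                   signedInsert (λ τ → x τ + y τ) v ρ ≈ signedInsert x v ρ + signedInsert y v ρ
  signedInsert-+ x y v []      = refl
  signedInsert-+ x y v (u ∷ ρ) with <Q-cmp v u
  ... | tri< _ _ _ = refl
  ... | tri≈ _ _ _ = sym (+-identityʳ 0#)
  ... | tri> _ _ _ = trans (-‿cong (signedInsert-+ (x ∘ (u ∷_)) (y ∘ (u ∷_)) v ρ)) (sym (-‿+-comm _ _))

  signedInsert²-repeat : ∀ {n k} (x : Vec (Q n) (suc (suc k)) → Carrier) v (ρ : Vec (Q n) k) →
                         signedInsert (signedInsert x v) v ρ ≈ 0#
  signedInsert²-repeat x v []      = reflexive (signedInsert-≡ x v [])
  signedInsert²-repeat x v (u ∷ ρ) = compare (<Q-cmp v u)
    where
    xu = x ∘ (u ∷_)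
    compare : Tri (v <Q u) (v ≡ u) (u <Q v) → signedInsert (signedInsert x v) v (u ∷ ρ) ≈ 0#
    compare (tri< v<u _ _) = reflexive (P.trans (signedInsert-< (signedInsert x v) ρ v<u) (signedInsert-≡ x v (u ∷ ρ)))
    compare (tri≈ _ P.refl _) = reflexive (signedInsert-≡ (signedInsert x v) v ρ)
    compare (tri> _ _ u<v) = begin
      signedInsert (signedInsert x v) v (u ∷ ρ)           ≡⟨ signedInsert-> (signedInsert x v) ρ u<v ⟩
      - signedInsert (λ τ → signedInsert x v (u ∷ τ)) v ρ ≈⟨ -‿cong (signedInsert-cong (λ τ → reflexive (signedInsert-> x τ u<v)) v ρ) ⟩
      - signedInsert (λ τ → - signedInsert xu v τ) v ρ    ≈⟨ -‿cong (signedInsert-neg _ v ρ) ⟩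
      - - signedInsert (signedInsert xu v) v ρ            ≈⟨ -‿involutive _ ⟩
      signedInsert (signedInsert xu v) v ρ                ≈⟨ signedInsert²-repeat xu v ρ ⟩
      0# ∎

  signedInsert²-swap< : ∀ {n k} {v w : Q n} → v <Q w → (x : Vec (Q n) (suc (suc k)) → Carrier) (ρ : Vec (Q n) k) →
                        signedInsert (signedInsert x v) w ρ ≈ - signedInsert (signedInsert x w) v ρ
  signedInsert²-swap< {v = v} {w} v<w x [] = begin
    signedInsert x v (w ∷ [])  ≡⟨ signedInsert-< x [] v<w ⟩
    x (v ∷ w ∷ [])             ≈⟨ sym (-‿involutive _) ⟩
    - - x (v ∷ w ∷ [])         ≡⟨ P.cong -_ (P.sym (signedInsert-> x [] v<w)) ⟩
    - signedInsert x w (v ∷ []) ∎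
  signedInsert²-swap< {v = v} {w} v<w x (u ∷ ρ) = compare-w (<Q-cmp w u)
    where
    goal = signedInsert (signedInsert x v) w (u ∷ ρ) ≈ - signedInsert (signedInsert x w) v (u ∷ ρ)
    xu = x ∘ (u ∷_)

    compare-v : u <Q w → Tri (v <Q u) (v ≡ u) (u <Q v) → goal
    compare-v u<w (tri< v<u _ _) = begin
      signedInsert (signedInsert x v) w (u ∷ ρ)        ≡⟨ signedInsert-> (signedInsert x v) ρ u<w ⟩
      - signedInsert (λ τ → signedInsert x v (u ∷ τ)) w ρ ≈⟨ -‿cong (signedInsert-cong (λ τ → reflexive (signedInsert-< x τ v<u)) w ρ) ⟩
      - signedInsert (λ τ → x (v ∷ u ∷ τ)) w ρ         ≈⟨ -‿cong (sym (-‿involutive _)) ⟩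
      - - - signedInsert (λ τ → x (v ∷ u ∷ τ)) w ρ     ≡⟨ P.cong (λ t → - - t) (P.sym (signedInsert-> (x ∘ (v ∷_)) ρ u<w)) ⟩
      - - signedInsert (x ∘ (v ∷_)) w (u ∷ ρ)          ≡⟨ P.cong -_ (P.sym (signedInsert-> x (u ∷ ρ) v<w)) ⟩
      - signedInsert x w (v ∷ u ∷ ρ)                   ≡⟨ P.cong -_ (P.sym (signedInsert-< (signedInsert x w) ρ v<u)) ⟩
      - signedInsert (signedInsert x w) v (u ∷ ρ)      ∎
    compare-v u<w (tri≈ _ P.refl _) = begin
      signedInsert (signedInsert x v) w (v ∷ ρ)        ≡⟨ signedInsert-> (signedInsert x v) ρ u<w ⟩
      - signedInsert (λ τ → signedInsert x v (v ∷ τ)) w ρ ≈⟨ -‿cong (signedInsert-zero (λ τ → reflexive (signedInsert-≡ x v τ)) w ρ) ⟩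
      - 0#                                             ≡⟨ P.cong -_ (P.sym (signedInsert-≡ (signedInsert x w) v ρ)) ⟩
      - signedInsert (signedInsert x w) v (v ∷ ρ)      ∎
    compare-v u<w (tri> _ _ u<v) = begin
      signedInsert (signedInsert x v) w (u ∷ ρ)        ≡⟨ signedInsert-> (signedInsert x v) ρ u<w ⟩
      - signedInsert (λ τ → signedInsert x v (u ∷ τ)) w ρ ≈⟨ -‿cong (signedInsert-cong (λ τ → reflexive (signedInsert-> x τ u<v)) w ρ) ⟩
      - signedInsert (λ τ → - signedInsert xu v τ) w ρ ≈⟨ -‿cong (signedInsert-neg _ w ρ) ⟩
      - - signedInsert (signedInsert xu v) w ρ         ≈⟨ -‿involutive _ ⟩
      signedInsert (signedInsert xu v) w ρ             ≈⟨ signedInsert²-swap< v<w xu ρ ⟩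
      - signedInsert (signedInsert xu w) v ρ           ≈⟨ -‿cong (sym (-‿involutive _)) ⟩
      - - - signedInsert (signedInsert xu w) v ρ       ≈⟨ -‿cong (-‿cong (sym (signedInsert-neg _ v ρ))) ⟩
      - - signedInsert (λ τ → - signedInsert xu w τ) v ρ ≈⟨ -‿cong (-‿cong (signedInsert-cong (λ τ → reflexive (P.sym (signedInsert-> x τ u<w))) v ρ)) ⟩
      - - signedInsert (λ τ → signedInsert x w (u ∷ τ)) v ρ ≡⟨ P.cong -_ (P.sym (signedInsert-> (signedInsert x w) ρ u<v)) ⟩
      - signedInsert (signedInsert x w) v (u ∷ ρ)      ∎

    compare-w : Tri (w <Q u) (w ≡ u) (u <Q w) → goal
    compare-w (tri< w<u _ _) = begin
      signedInsert (signedInsert x v) w (u ∷ ρ)        ≡⟨ signedInsert-< (signedInsert x v) ρ w<u ⟩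
      signedInsert x v (w ∷ u ∷ ρ)                     ≡⟨ signedInsert-< x (u ∷ ρ) v<w ⟩
      x (v ∷ w ∷ u ∷ ρ)                                ≈⟨ sym (-‿involutive _) ⟩
      - - x (v ∷ w ∷ u ∷ ρ)                            ≡⟨ P.cong (λ t → - - t) (P.sym (signedInsert-< (x ∘ (v ∷_)) ρ w<u)) ⟩
      - - signedInsert (x ∘ (v ∷_)) w (u ∷ ρ)          ≡⟨ P.cong -_ (P.sym (signedInsert-> x (u ∷ ρ) v<w)) ⟩
      - signedInsert x w (v ∷ u ∷ ρ)                   ≡⟨ P.cong -_ (P.sym (signedInsert-< (signedInsert x w) ρ (<Q-trans v<w w<u))) ⟩
      - signedInsert (signedInsert x w) v (u ∷ ρ)      ∎
    compare-w (tri≈ _ P.refl _) = begin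
      signedInsert (signedInsert x v) w (w ∷ ρ)        ≡⟨ signedInsert-≡ (signedInsert x v) w ρ ⟩
      0#                                               ≈⟨ sym (trans (-‿cong -0#≈0#) -0#≈0#) ⟩
      - - 0#                                           ≡⟨ P.cong (λ t → - - t) (P.sym (signedInsert-≡ (x ∘ (v ∷_)) w ρ)) ⟩
      - - signedInsert (x ∘ (v ∷_)) w (w ∷ ρ)          ≡⟨ P.cong -_ (P.sym (signedInsert-> x (w ∷ ρ) v<w)) ⟩
      - signedInsert x w (v ∷ w ∷ ρ)                   ≡⟨ P.cong -_ (P.sym (signedInsert-< (signedInsert x w) ρ v<w)) ⟩
      - signedInsert (signedInsert x w) v (w ∷ ρ)      ∎
    compare-w (tri> _ _ u<w) = compare-v u<w (<Q-cmp v u)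

  signedInsert²-swap : ∀ {n k} (x : Vec (Q n) (suc (suc k)) → Carrier) v w (ρ : Vec (Q n) k) →
                       signedInsert (signedInsert x v) w ρ ≈ - signedInsert (signedInsert x w) v ρ
  signedInsert²-swap x v w ρ with <Q-cmp v w
  ... | tri< v<w _ _   = signedInsert²-swap< v<w x ρ
  ... | tri≈ _ P.refl _ = trans (signedInsert²-repeat x v ρ) (sym (trans (-‿cong (signedInsert²-repeat x v ρ)) -0#≈0#))
  ... | tri> _ _ w<v   = trans (sym (-‿involutive _)) (-‿cong (sym (signedInsert²-swap< w<v x ρ)))

  alternate : ∀ {n} k → (Vec (Q n) k → Carrier) → Vec (Q n) k → Carrier
  alternate zero    x []      = x []
  alternate (suc k) x (v ∷ σ) = alternate k (signedInsert x v) σ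

  alternate-cong : ∀ {n} k {x y : Vec (Q n) k → Carrier} → (∀ τ → x τ ≈ y τ) → ∀ σ → alternate k x σ ≈ alternate k y σ
  alternate-cong zero    e []      = e []
  alternate-cong (suc k) e (v ∷ σ) = alternate-cong k (signedInsert-cong e v) σ

  alternate-∘ : ∀ {n} k (f : Carrier → Carrier) → f 0# ≈ 0# → (∀ a → f (- a) ≈ - f a) →
                (x : Vec (Q n) k → Carrier) → ∀ σ → alternate k (f ∘ x) σ ≈ f (alternate k x σ)
  alternate-∘ zero    f f0 f- x []      = refl
  alternate-∘ (suc k) f f0 f- x (v ∷ σ) =
    trans (alternate-cong k (signedInsert-∘ f f0 f- x v) σ) (alternate-∘ k f f0 f- (signedInsert x v) σ)

  alternate-neg : ∀ {n} k (x : Vec (Q n) k → Carrier) → ∀ σ → alternate k (λ τ → - x τ) σ ≈ - alternate k x σ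
  alternate-neg k = alternate-∘ k -_ -0#≈0# (λ _ → refl)

  alternate-* : ∀ {n} k (d : Carrier) (x : Vec (Q n) k → Carrier) → ∀ σ → alternate k (λ τ → d * x τ) σ ≈ d * alternate k x σ
  alternate-* k d = alternate-∘ k (d *_) (zeroʳ d) (λ a → sym (-‿distribʳ-* d a))

  alternate-zero : ∀ {n} k {x : Vec (Q n) k → Carrier} → (∀ τ → x τ ≈ 0#) → ∀ σ → alternate k x σ ≈ 0#
  alternate-zero {n} k {x} e σ =
    trans (alternate-cong k e σ) (alternate-∘ k (λ _ → 0#) refl (λ _ → sym -0#≈0#) (λ (_ : Vec (Q n) k) → 0#) σ)

  alternate-+ : ∀ {n} k (x y : Vec (Q n) k → Carrier) → ∀ σ → alternate k (λ τ → x τ + y τ) σ ≈ alternate k x σ + alternate k y σ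
  alternate-+ zero    x y []      = refl
  alternate-+ (suc k) x y (v ∷ σ) =
    trans (alternate-cong k (signedInsert-+ x y v) σ) (alternate-+ k (signedInsert x v) (signedInsert y v) σ)

  -- The recursion of signedInsert fixes a head vertex in front of the tuple.
  IncreasingAfter : ∀ {n k} → Maybe (Q n) → Vec (Q n) k → Set
  IncreasingAfter nothing  τ = Increasing τ
  IncreasingAfter (just b) τ = Increasing (b ∷ τ)

  Above : ∀ {n} → Maybe (Q n) → Q n → Set
  Above nothing  v = ⊤
  Above (just b) v = b <Q v

  signedInsert-congIncreasing : ∀ {n k} (β : Maybe (Q n)) {x y : Vec (Q n) (suc k) → Carrier} →
                                (∀ τ → IncreasingAfter β τ → x τ ≈ y τ) →
                                ∀ v ρ → Above β v → IncreasingAfter β ρ → signedInsert x v ρ ≈ signedInsert y v ρ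
  signedInsert-congIncreasing nothing  e v [] _   _ = e _ [ v ]
  signedInsert-congIncreasing (just b) e v [] b<v _ = e _ (b<v ∷ [ v ])
  signedInsert-congIncreasing β e v (u ∷ ρ) β<v ρ↑ with <Q-cmp v u
  signedInsert-congIncreasing nothing  e v (u ∷ ρ) _   ρ↑ | tri< v<u _ _ = e _ (v<u ∷ ρ↑)
  signedInsert-congIncreasing (just b) e v (u ∷ ρ) b<v ρ↑ | tri< v<u _ _ = e _ (b<v ∷ v<u ∷ increasing-tail ρ↑)
  ... | tri≈ _ _ _ = refl
  signedInsert-congIncreasing nothing  e v (u ∷ ρ) _   ρ↑ | tri> _ _ u<v =
    -‿cong (signedInsert-congIncreasing (just u) (e ∘ (u ∷_)) v ρ u<v ρ↑)
  signedInsert-congIncreasing (just b) e v (u ∷ ρ) b<v ρ↑ | tri> _ _ u<v =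
    -‿cong (signedInsert-congIncreasing (just u) (λ τ u∷τ↑ → e (u ∷ τ) (increasing-head< ρ↑ (here P.refl) ∷ u∷τ↑))
                                        v ρ u<v (increasing-tail ρ↑))

  alternate-congIncreasing : ∀ {n} k {x y : Vec (Q n) k → Carrier} → (∀ τ → Increasing τ → x τ ≈ y τ) →
                             ∀ σ → alternate k x σ ≈ alternate k y σ
  alternate-congIncreasing zero    e []      = e [] []
  alternate-congIncreasing (suc k) e (v ∷ σ) =
    alternate-congIncreasing k (λ τ τ↑ → signedInsert-congIncreasing nothing e v τ tt τ↑) σ

  alternate-increasing : ∀ {n} k (x : Vec (Q n) k → Carrier) → ∀ τ → Increasing τ → alternate k x τ ≈ x τ
  alternate-increasing zero    x []      τ↑ = refl
  alternate-increasing (suc k) x (v ∷ σ) τ↑ = trans (alternate-increasing k (signedInsert x v) σ (increasing-tail τ↑)) (head σ τ↑)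
    where
    head : ∀ σ → Increasing (v ∷ σ) → signedInsert x v σ ≈ x (v ∷ σ)
    head []      _  = refl
    head (u ∷ ρ) v∷σ↑ = reflexive (signedInsert-< x ρ (increasing-head< v∷σ↑ (here P.refl)))

  IsAlternating : ∀ {n} k → (Vec (Q n) k → Carrier) → Set ℓ
  IsAlternating     zero          X = Level.Lift ℓ ⊤
  IsAlternating     (suc zero)    X = Level.Lift ℓ ⊤
  IsAlternating {n} (suc (suc k)) X =
    (∀ v w σ → X (v ∷ w ∷ σ) ≈ - X (w ∷ v ∷ σ)) ×
    (∀ v σ → X (v ∷ v ∷ σ) ≈ 0#) ×
    (∀ (v : Q n) → IsAlternating (suc k) (X ∘ (v ∷_)))

  IsAlternating-tail : ∀ {n} k {X : Vec (Q n) (suc k) → Carrier} → IsAlternating (suc k) X →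
                       ∀ v → IsAlternating k (X ∘ (v ∷_))
  IsAlternating-tail zero    _             v = Level.lift tt
  IsAlternating-tail (suc k) (_ , _ , alt) v = alt v

  IsAlternating-cong : ∀ {n} k {X Y : Vec (Q n) k → Carrier} → (∀ σ → X σ ≈ Y σ) → IsAlternating k X → IsAlternating k Y
  IsAlternating-cong zero          e _ = Level.lift tt
  IsAlternating-cong (suc zero)    e _ = Level.lift tt
  IsAlternating-cong (suc (suc k)) e (anti , rep , alt) =
    (λ v w σ → trans (sym (e _)) (trans (anti v w σ) (-‿cong (e _)))) ,
    (λ v σ → trans (sym (e _)) (rep v σ)) ,
    (λ v → IsAlternating-cong (suc k) (e ∘ (v ∷_)) (alt v))

  IsAlternating-0 : ∀ {n} k → IsAlternating {n} k (λ _ → 0#)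
  IsAlternating-0 zero          = Level.lift tt
  IsAlternating-0 (suc zero)    = Level.lift tt
  IsAlternating-0 (suc (suc k)) = (λ v w σ → sym -0#≈0#) , (λ v σ → refl) , (λ v → IsAlternating-0 (suc k))

  IsAlternating-if : ∀ {n} k (b : Bool) {X : Vec (Q n) k → Carrier} → IsAlternating k X →
                     IsAlternating k (λ σ → if b then X σ else 0#)
  IsAlternating-if k true  alt = alt
  IsAlternating-if k false alt = IsAlternating-0 k

  IsAlternating-ΣL : ∀ {n a} {A : Set a} k (xs : List A) (F : A → Vec (Q n) k → Carrier) →
                     (∀ x → IsAlternating k (F x)) → IsAlternating k (λ σ → ΣL xs (λ x → F x σ))
  IsAlternating-ΣL zero          xs F alt = Level.lift tt
  IsAlternating-ΣL (suc zero)    xs F alt = Level.lift tt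
  IsAlternating-ΣL (suc (suc k)) xs F alt =
    (λ v w σ → trans (ΣL-cong xs (λ x → proj₁ (alt x) v w σ)) (sym (ΣL-neg xs _))) ,
    (λ v σ → ΣL-zero xs (λ x → proj₁ (proj₂ (alt x)) v σ)) ,
    (λ v → IsAlternating-ΣL (suc k) xs (λ x → F x ∘ (v ∷_)) (λ x → proj₂ (proj₂ (alt x)) v))

  alternate-isAlternating : ∀ {n} k (x : Vec (Q n) k → Carrier) → IsAlternating k (alternate k x)
  alternate-isAlternating zero          x = Level.lift tt
  alternate-isAlternating (suc zero)    x = Level.lift tt
  alternate-isAlternating (suc (suc k)) x =
    (λ v w σ → trans (alternate-cong k (signedInsert²-swap x v w) σ) (alternate-neg k _ σ)) ,
    (λ v σ → alternate-zero k (signedInsert²-repeat x v) σ) ,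
    (λ v → alternate-isAlternating (suc k) (signedInsert x v))

  signedInsert-alternating : ∀ {n} k {Y : Vec (Q n) (suc k) → Carrier} → IsAlternating (suc k) Y →
                             ∀ v ρ → signedInsert Y v ρ ≈ Y (v ∷ ρ)
  signedInsert-alternating k       alt v [] = refl
  signedInsert-alternating (suc k) (anti , rep , alt) v (u ∷ ρ) with <Q-cmp v u
  ... | tri< _ _ _      = refl
  ... | tri≈ _ P.refl _ = sym (rep v ρ)
  ... | tri> _ _ _      = trans (-‿cong (signedInsert-alternating k (alt u) v ρ)) (sym (anti v u ρ))

  alternate-alternating : ∀ {n} k {Y : Vec (Q n) k → Carrier} → IsAlternating k Y → ∀ σ → alternate k Y σ ≈ Y σ
  alternate-alternating zero    alt []      = refl
  alternate-alternating (suc k) alt (v ∷ σ) =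
    trans (alternate-cong k (signedInsert-alternating k alt v) σ) (alternate-alternating k (IsAlternating-tail k alt v) σ)

  -- On alternating functions of all tuples these are the simplicial boundary
  -- and the pushforward along h.
  ∂ₐ : ∀ {n k} → (Vec (Q n) (suc k) → Carrier) → Vec (Q n) k → Carrier
  ∂ₐ {n} X σ = ΣL (allQ n) (λ v → X (v ∷ σ))

  pushAll : ∀ {a b k} → (Q a → Q b) → (Vec (Q a) k → Carrier) → Vec (Q b) k → Carrier
  pushAll {k = k} h X τ = ΣT k (λ σ → if map h σ ==V τ then X σ else 0#)

  IsAlternating-∂ₐ : ∀ {n} k {X : Vec (Q n) (suc k) → Carrier} → IsAlternating (suc k) X → IsAlternating k (∂ₐ X)
  IsAlternating-∂ₐ {n} k {X} alt = IsAlternating-ΣL k (allQ n) (λ v → X ∘ (v ∷_)) (IsAlternating-tail k alt)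

  pushAll-cong : ∀ {a b k} (h : Q a → Q b) {X Y : Vec (Q a) k → Carrier} → (∀ σ → X σ ≈ Y σ) →
                 ∀ τ → pushAll h X τ ≈ pushAll h Y τ
  pushAll-cong {k = k} h e τ = ΣT-cong k (λ σ → if-cong (map h σ ==V τ) (e σ))

  pushAll-cong-map : ∀ {a b k} {h h' : Q a → Q b} → (∀ x → h x ≡ h' x) → (X : Vec (Q a) k → Carrier) →
                     ∀ τ → pushAll h X τ ≈ pushAll h' X τ
  pushAll-cong-map {k = k} e X τ =
    ΣT-cong k (λ σ → reflexive (P.cong (λ ρ → if ρ ==V τ then X σ else 0#) (VP.map-cong e σ)))

  pushAll-+ : ∀ {a b k} (h : Q a → Q b) (X Y : Vec (Q a) k → Carrier) →
              ∀ τ → pushAll h (λ σ → X σ + Y σ) τ ≈ pushAll h X τ + pushAll h Y τ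
  pushAll-+ {k = k} h X Y τ = trans (ΣT-cong k (λ σ → if-+ (map h σ ==V τ) _ _)) (ΣT-+ k _ _)

  pushAll-* : ∀ {a b k} (h : Q a → Q b) (d : Carrier) (X : Vec (Q a) k → Carrier) →
              ∀ τ → pushAll h (λ σ → d * X σ) τ ≈ d * pushAll h X τ
  pushAll-* {k = k} h d X τ = trans (ΣT-cong k (λ σ → sym (if-* (map h σ ==V τ) d _))) (sym (ΣT-* k d _))

  pushAll-zero : ∀ {a b k} (h : Q a → Q b) {X : Vec (Q a) k → Carrier} → (∀ σ → X σ ≈ 0#) → ∀ τ → pushAll h X τ ≈ 0#
  pushAll-zero {k = k} h e τ = ΣT-zero k (λ σ → if-zero (map h σ ==V τ) (e σ))

  pushAll-id : ∀ {a k} (X : Vec (Q a) k → Carrier) → ∀ τ → pushAll id X τ ≈ X τ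
  pushAll-id {k = k} X τ =
    trans (ΣT-cong k (λ σ → reflexive (P.cong (λ ρ → if ρ ==V τ then X σ else 0#) (VP.map-id σ)))) (ΣT-δ k τ X)

  ∂ₐ-pushAll : ∀ {a b k} (h : Q a → Q b) (X : Vec (Q a) (suc k) → Carrier) → ∀ τ → ∂ₐ (pushAll h X) τ ≈ pushAll h (∂ₐ X) τ
  ∂ₐ-pushAll {a} {b} {k} h X τ = begin
    ΣL (allQ b) (λ w → ΣL (allQ a) (λ v → ΣT k (λ σ → if (h v ==Q w) ∧ (map h σ ==V τ) then X (v ∷ σ) else 0#)))
      ≈⟨ ΣL-swap (allQ b) (allQ a) _ ⟩
    ΣL (allQ a) (λ v → ΣL (allQ b) (λ w → ΣT k (λ σ → if (h v ==Q w) ∧ (map h σ ==V τ) then X (v ∷ σ) else 0#)))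
      ≈⟨ ΣL-cong (allQ a) (λ v → ΣL-cong (allQ b) (λ w →
           trans (ΣT-cong k (λ σ → reflexive (if-∧ (h v ==Q w) (map h σ ==V τ) _))) (sym (ΣT-if k (h v ==Q w) _)))) ⟩
    ΣL (allQ a) (λ v → ΣL (allQ b) (λ w → if h v ==Q w then ΣT k (λ σ → if map h σ ==V τ then X (v ∷ σ) else 0#) else 0#))
      ≈⟨ ΣL-cong (allQ a) (λ v → allQ-δ' b (h v) _) ⟩
    ΣL (allQ a) (λ v → ΣT k (λ σ → if map h σ ==V τ then X (v ∷ σ) else 0#))
      ≈⟨ sym (ΣT-swapL k (allQ a) _) ⟩
    ΣT k (λ σ → ΣL (allQ a) (λ v → if map h σ ==V τ then X (v ∷ σ) else 0#))
      ≈⟨ ΣT-cong k (λ σ → sym (ΣL-if (map h σ ==V τ) (allQ a) _)) ⟩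
    pushAll h (∂ₐ X) τ ∎

  pushAll-∘ : ∀ {a b d k} (h : Q b → Q d) (g : Q a → Q b) (X : Vec (Q a) k → Carrier) →
              ∀ τ → pushAll h (pushAll g X) τ ≈ pushAll (h ∘ g) X τ
  pushAll-∘ {k = k} h g X τ = begin
    ΣT k (λ ρ → if map h ρ ==V τ then ΣT k (λ σ → if map g σ ==V ρ then X σ else 0#) else 0#)
      ≈⟨ ΣT-cong k (λ ρ → ΣT-if k (map h ρ ==V τ) _) ⟩
    ΣT k (λ ρ → ΣT k (λ σ → if map h ρ ==V τ then (if map g σ ==V ρ then X σ else 0#) else 0#))
      ≈⟨ ΣT-swap k k _ ⟩
    ΣT k (λ σ → ΣT k (λ ρ → if map h ρ ==V τ then (if map g σ ==V ρ then X σ else 0#) else 0#))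
      ≈⟨ ΣT-cong k (λ σ → ΣT-cong k (λ ρ → reflexive (if-comm (map h ρ ==V τ) (map g σ ==V ρ) _))) ⟩
    ΣT k (λ σ → ΣT k (λ ρ → if map g σ ==V ρ then (if map h ρ ==V τ then X σ else 0#) else 0#))
      ≈⟨ ΣT-cong k (λ σ → ΣT-δ' k (map g σ) (λ ρ → if map h ρ ==V τ then X σ else 0#)) ⟩
    ΣT k (λ σ → if map h (map g σ) ==V τ then X σ else 0#)
      ≈⟨ ΣT-cong k (λ σ → reflexive (P.cong (λ ρ → if ρ ==V τ then X σ else 0#) (P.sym (VP.map-∘ h g σ)))) ⟩
    pushAll (h ∘ g) X τ ∎

  IsAlternating-pushAll : ∀ {a b} k (h : Q a → Q b) {X : Vec (Q a) k → Carrier} → IsAlternating k X →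
                          IsAlternating k (pushAll h X)
  IsAlternating-pushAll zero       h _ = Level.lift tt
  IsAlternating-pushAll (suc zero) h _ = Level.lift tt
  IsAlternating-pushAll {a} {b} (suc (suc k)) h {X} (anti , rep , alt) =
    anti′ , rep′ , λ p → alt′ p (λ u → IsAlternating-pushAll (suc k) h (alt u))
    where
    T : Q b → Q b → Vec (Q b) k → Q a → Q a → Carrier
    T p q τ u v = ΣT k (λ σ → if (h u ==Q p) ∧ ((h v ==Q q) ∧ (map h σ ==V τ)) then X (u ∷ v ∷ σ) else 0#)

    T-anti : ∀ p q τ u v → T p q τ u v ≈ - T q p τ v u
    T-anti p q τ u v = trans
      (ΣT-cong k (λ σ → trans
        (reflexive (P.cong (λ b → if b then X (u ∷ v ∷ σ) else 0#) (∧-x∙yz≈y∙xz (h u ==Q p) (h v ==Q q) (map h σ ==V τ))))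
        (trans (if-cong ((h v ==Q q) ∧ ((h u ==Q p) ∧ (map h σ ==V τ))) (anti u v σ)) (sym (if-neg _ _)))))
      (sym (ΣT-neg k _))

    anti′ : ∀ p q τ → pushAll h X (p ∷ q ∷ τ) ≈ - pushAll h X (q ∷ p ∷ τ)
    anti′ p q τ = begin
      ΣL (allQ a) (λ u → ΣL (allQ a) (T p q τ u))          ≈⟨ ΣL-cong (allQ a) (λ u → ΣL-cong (allQ a) (T-anti p q τ u)) ⟩
      ΣL (allQ a) (λ u → ΣL (allQ a) (λ v → - T q p τ v u)) ≈⟨ ΣL-swap (allQ a) (allQ a) _ ⟩
      ΣL (allQ a) (λ v → ΣL (allQ a) (λ u → - T q p τ v u)) ≈⟨ ΣL-cong (allQ a) (λ v → sym (ΣL-neg (allQ a) _)) ⟩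
      ΣL (allQ a) (λ v → - ΣL (allQ a) (T q p τ v))        ≈⟨ sym (ΣL-neg (allQ a) _) ⟩
      - ΣL (allQ a) (λ v → ΣL (allQ a) (T q p τ v))        ∎

    rep′ : ∀ p τ → pushAll h X (p ∷ p ∷ τ) ≈ 0#
    rep′ p τ = ΣL²-antisymmetric (allQ a) (T p p τ) (T-anti p p τ)
                 (λ u → ΣT-zero k (λ σ → if-zero ((h u ==Q p) ∧ ((h u ==Q p) ∧ (map h σ ==V τ))) (rep u σ)))

    alt′ : ∀ p → (∀ u → IsAlternating (suc k) (pushAll h (X ∘ (u ∷_)))) → IsAlternating (suc k) (pushAll h X ∘ (p ∷_))
    alt′ p pushAll-alt = IsAlternating-cong (suc k) split
               (IsAlternating-ΣL (suc k) (allQ a) (λ u τ → if h u ==Q p then pushAll h (X ∘ (u ∷_)) τ else 0#)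
                  (λ u → IsAlternating-if (suc k) (h u ==Q p) (pushAll-alt u)))
      where
      split : ∀ τ → ΣL (allQ a) (λ u → if h u ==Q p then pushAll h (X ∘ (u ∷_)) τ else 0#) ≈ pushAll h X (p ∷ τ)
      split τ = ΣL-cong (allQ a) (λ u →
        trans (ΣT-if (suc k) (h u ==Q p) (λ σ → if map h σ ==V τ then X (u ∷ σ) else 0#))
              (ΣT-cong (suc k) (λ σ → reflexive (P.sym (if-∧ (h u ==Q p) (map h σ ==V τ) (X (u ∷ σ)))))))

  -- Pushforward of chains along non-expanding maps

  SupportedOnIncreasing : ∀ {n k} → (Vec (Q n) k → Carrier) → Set ℓ
  SupportedOnIncreasing x = ∀ τ → ¬ Increasing τ → x τ ≈ 0#

  supported-tail : ∀ {n k} {x : Vec (Q n) (suc k) → Carrier} → SupportedOnIncreasing x →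
                   ∀ u → SupportedOnIncreasing (x ∘ (u ∷_))
  supported-tail x↑ u τ ¬τ↑ = x↑ (u ∷ τ) (¬τ↑ ∘ increasing-tail)

  chain-supported : ∀ {n k} r (x : Vec (Q n) k → Carrier) → (∀ ρ → ¬ IsSimplex r ρ → x ρ ≈ 0#) → SupportedOnIncreasing x
  chain-supported r x x-chain τ ¬τ↑ = x-chain τ (¬τ↑ ∘ proj₁)

  restrict : ∀ {n k} → (Vec (Q n) k → Carrier) → Vec (Q n) k → Carrier
  restrict Y τ = if does (increasing? τ) then Y τ else 0#

  restrict-supported : ∀ {n k} (Y : Vec (Q n) k → Carrier) → SupportedOnIncreasing (restrict Y)
  restrict-supported Y τ ¬τ↑ with increasing? τ
  ... | yes τ↑ = ⊥-elim (¬τ↑ τ↑)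
  ... | no  _  = refl

  restrict-increasing : ∀ {n k} (Y : Vec (Q n) k → Carrier) τ → Increasing τ → restrict Y τ ≈ Y τ
  restrict-increasing Y τ τ↑ with increasing? τ
  ... | yes _   = refl
  ... | no ¬τ↑ = ⊥-elim (¬τ↑ τ↑)

  restrict-cong : ∀ {n k} {Y Z : Vec (Q n) k → Carrier} → (∀ τ → Increasing τ → Y τ ≈ Z τ) →
                  ∀ τ → restrict Y τ ≈ restrict Z τ
  restrict-cong e τ with increasing? τ
  ... | yes τ↑ = e τ τ↑
  ... | no  _  = refl

  restrict-supported-id : ∀ {n k} (Y : Vec (Q n) k → Carrier) → SupportedOnIncreasing Y → ∀ τ → restrict Y τ ≈ Y τ
  restrict-supported-id Y Y↑ τ with increasing? τ
  ... | yes _   = refl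
  ... | no ¬τ↑ = sym (Y↑ τ ¬τ↑)

  alternate-restrict : ∀ {n} k (Y : Vec (Q n) k → Carrier) → IsAlternating k Y → ∀ σ → alternate k (restrict Y) σ ≈ Y σ
  alternate-restrict k Y alt σ =
    trans (alternate-congIncreasing k (restrict-increasing Y) σ) (alternate-alternating k alt σ)

  -- The inner sum is the summand of ∂ in Defs.
  alternatingSum-signedInsert : ∀ {n k} (x : Vec (Q n) (suc k) → Carrier) → SupportedOnIncreasing x →
                                ∀ v (ρ : Vec (Q n) k) → Increasing ρ →
                                sumFin (λ j → sgn j * x (insertAt ρ j v)) ≈ signedInsert x v ρ
  alternatingSum-signedInsert x x↑ v []      _  = trans (+-identityʳ _) (*-identityˡ _)
  alternatingSum-signedInsert x x↑ v (u ∷ ρ) ρ↑ = compare (<Q-cmp v u)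
    where
    later : Carrier
    later = sumFin (λ j → sgn (suc j) * x (u ∷ insertAt ρ j v))

    later-neg : later ≈ - sumFin (λ j → sgn j * x (u ∷ insertAt ρ j v))
    later-neg = trans (sumFin-cong (λ j → sym (-‿distribˡ-* (sgn j) (x (u ∷ insertAt ρ j v)))))
                      (sym (sumFin-neg (λ j → sgn j * x (u ∷ insertAt ρ j v))))

    later-zero : ¬ (u <Q v) → later ≈ 0#
    later-zero u≮v = sumFin-zero (λ j →
      trans (*-congˡ (x↑ (u ∷ insertAt ρ j v) (u≮v ∘ (λ τ↑ → increasing-head< τ↑ (insertAt-∈ ρ j v))))) (zeroʳ (sgn (suc j))))

    compare : Tri (v <Q u) (v ≡ u) (u <Q v) → 1# * x (v ∷ u ∷ ρ) + later ≈ signedInsert x v (u ∷ ρ)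
    compare (tri< v<u _ _) = begin
      1# * x (v ∷ u ∷ ρ) + later ≈⟨ +-cong (*-identityˡ _) (later-zero (<Q-asym v<u)) ⟩
      x (v ∷ u ∷ ρ) + 0#         ≈⟨ +-identityʳ _ ⟩
      x (v ∷ u ∷ ρ)              ≡⟨ P.sym (signedInsert-< x ρ v<u) ⟩
      signedInsert x v (u ∷ ρ)   ∎
    compare (tri≈ _ P.refl _) = begin
      1# * x (v ∷ v ∷ ρ) + later ≈⟨ +-cong (trans (*-identityˡ _) (x↑ _ (λ τ↑ → <Q-irrefl (increasing-head< τ↑ (here P.refl)))))
                                           (later-zero <Q-irrefl) ⟩
      0# + 0#                    ≈⟨ +-identityʳ _ ⟩
      0#                         ≡⟨ P.sym (signedInsert-≡ x v ρ) ⟩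
      signedInsert x v (v ∷ ρ)   ∎
    compare (tri> _ _ u<v) = begin
      1# * x (v ∷ u ∷ ρ) + later
        ≈⟨ +-cong (trans (*-identityˡ _) (x↑ _ (λ τ↑ → <Q-asym u<v (increasing-head< τ↑ (here P.refl))))) later-neg ⟩
      0# + - sumFin (λ j → sgn j * x (u ∷ insertAt ρ j v))
        ≈⟨ +-identityˡ _ ⟩
      - sumFin (λ j → sgn j * x (u ∷ insertAt ρ j v))
        ≈⟨ -‿cong (alternatingSum-signedInsert (x ∘ (u ∷_)) (supported-tail x↑ u) v ρ (increasing-tail ρ↑)) ⟩
      - signedInsert (x ∘ (u ∷_)) v ρ
        ≡⟨ P.sym (signedInsert-> x ρ u<v) ⟩
      signedInsert x v (u ∷ ρ) ∎

  ∂-alternate : ∀ {n q} (x : Chain n (suc q)) → SupportedOnIncreasing x →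
                ∀ σ → ∂ x σ ≈ restrict (∂ₐ (alternate (suc (suc q)) x)) σ
  ∂-alternate {n} {q} x x↑ σ with increasing? σ
  ... | yes σ↑ = ΣL-cong (allQ n) (λ v →
          trans (alternatingSum-signedInsert x x↑ v σ σ↑) (sym (alternate-increasing (suc q) (signedInsert x v) σ σ↑)))
  ... | no ¬σ↑ = ΣL-zero (allQ n) (λ v → sumFin-zero (λ j →
          trans (*-congˡ (x↑ (insertAt σ j v) (¬σ↑ ∘ increasing-insertAt⁻ σ j v))) (zeroʳ (sgn j))))

  -- h may reorder or identify vertices, hence the detour through alternating
  -- functions of all tuples.
  pushforward : ∀ {a b} k → (Q a → Q b) → (Vec (Q a) k → Carrier) → Vec (Q b) k → Carrier
  pushforward k h x = restrict (pushAll h (alternate k x))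

  pushforward-supported : ∀ {a b} k (h : Q a → Q b) x → SupportedOnIncreasing (pushforward k h x)
  pushforward-supported k h x = restrict-supported _

  alternate-pushforward : ∀ {a b} k (h : Q a → Q b) (x : Vec (Q a) k → Carrier) →
                          ∀ σ → alternate k (pushforward k h x) σ ≈ pushAll h (alternate k x) σ
  alternate-pushforward k h x =
    alternate-restrict k (pushAll h (alternate k x)) (IsAlternating-pushAll k h {alternate k x} (alternate-isAlternating k x))

  alternate-∂ : ∀ {n q} (x : Chain n (suc q)) → SupportedOnIncreasing x →
                ∀ σ → alternate (suc q) (∂ x) σ ≈ ∂ₐ (alternate (suc (suc q)) x) σ
  alternate-∂ {q = q} x x↑ σ =
    trans (alternate-cong (suc q) (∂-alternate x x↑) σ)
          (alternate-restrict (suc q) (∂ₐ (alternate (suc (suc q)) x)) (IsAlternating-∂ₐ (suc q) {alternate (suc (suc q)) x} (alternate-isAlternating (suc (suc q)) x)) σ)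

  pushforward-∂ : ∀ {a b} q (h : Q a → Q b) (x : Chain a (suc q)) → SupportedOnIncreasing x →
                  ∀ τ → ∂ (pushforward (suc (suc q)) h x) τ ≈ pushforward (suc q) h (∂ x) τ
  pushforward-∂ {b = b} q h x x↑ τ = begin
    ∂ (pushforward (2+q) h x) τ                  ≈⟨ ∂-alternate _ (pushforward-supported (2+q) h x) τ ⟩
    restrict (∂ₐ (alternate (2+q) (pushforward (2+q) h x))) τ
      ≈⟨ restrict-cong {Y = ∂ₐ (alternate (2+q) (pushforward (2+q) h x))}
                       (λ τ′ _ → ΣL-cong (allQ b) (λ v → alternate-pushforward (2+q) h x (v ∷ τ′))) τ ⟩
    restrict (∂ₐ (pushAll h (alternate (2+q) x))) τ
      ≈⟨ restrict-cong {Y = ∂ₐ (pushAll h (alternate (2+q) x))} (λ τ′ _ → ∂ₐ-pushAll h (alternate (2+q) x) τ′) τ ⟩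
    restrict (pushAll h (∂ₐ (alternate (2+q) x))) τ
      ≈⟨ restrict-cong {Y = pushAll h (∂ₐ (alternate (2+q) x))}
                       (λ τ′ _ → pushAll-cong h (λ σ → sym (alternate-∂ x x↑ σ)) τ′) τ ⟩
    pushforward (suc q) h (∂ x) τ ∎
    where 2+q = suc (suc q)

  pushforward-∘ : ∀ {a b d} k (h : Q b → Q d) (g : Q a → Q b) (x : Vec (Q a) k → Carrier) →
                  ∀ τ → pushforward k h (pushforward k g x) τ ≈ pushforward k (h ∘ g) x τ
  pushforward-∘ k h g x =
    restrict-cong (λ τ _ → trans (pushAll-cong h (alternate-pushforward k g x) τ) (pushAll-∘ h g _ τ))

  pushforward-id : ∀ {a} k (x : Vec (Q a) k → Carrier) → SupportedOnIncreasing x → ∀ τ → pushforward k id x τ ≈ x τ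
  pushforward-id k x x↑ τ =
    trans (restrict-cong (λ τ′ τ′↑ → trans (pushAll-id _ τ′) (alternate-increasing k x τ′ τ′↑)) τ) (restrict-supported-id x x↑ τ)

  pushforward-cong-map : ∀ {a b} k {h h' : Q a → Q b} → (∀ y → h y ≡ h' y) → (x : Vec (Q a) k → Carrier) →
                         ∀ τ → pushforward k h x τ ≈ pushforward k h' x τ
  pushforward-cong-map k e x = restrict-cong (λ τ _ → pushAll-cong-map e _ τ)

  pushforward-cong : ∀ {a b} k (h : Q a → Q b) {x y : Vec (Q a) k → Carrier} → (∀ σ → x σ ≈ y σ) →
                     ∀ τ → pushforward k h x τ ≈ pushforward k h y τ
  pushforward-cong k h e = restrict-cong (λ τ _ → pushAll-cong h (alternate-cong k e) τ)

  pushforward-+ : ∀ {a b} k (h : Q a → Q b) (x y : Vec (Q a) k → Carrier) →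
                  ∀ τ → pushforward k h (λ σ → x σ + y σ) τ ≈ pushforward k h x τ + pushforward k h y τ
  pushforward-+ k h x y τ =
    trans (restrict-cong (λ τ′ _ → trans (pushAll-cong h (alternate-+ k x y) τ′) (pushAll-+ h _ _ τ′)) τ)
          (if-+ (does (increasing? τ)) _ _)

  pushforward-* : ∀ {a b} k (h : Q a → Q b) (d : Carrier) (x : Vec (Q a) k → Carrier) →
                  ∀ τ → pushforward k h (λ σ → d * x σ) τ ≈ d * pushforward k h x τ
  pushforward-* k h d x τ =
    trans (restrict-cong (λ τ′ _ → trans (pushAll-cong h (alternate-* k d x) τ′) (pushAll-* h d _ τ′)) τ)
          (sym (if-* (does (increasing? τ)) d _))

  pushforward-zero : ∀ {a b} k (h : Q a → Q b) {x : Vec (Q a) k → Carrier} → (∀ σ → x σ ≈ 0#) →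
                     ∀ τ → pushforward k h x τ ≈ 0#
  pushforward-zero k h e τ = if-zero (does (increasing? τ)) (pushAll-zero h (alternate-zero k e) τ)

  signedInsert-covering : ∀ {n k} (y : Vec (Q n) (suc k) → Carrier) v (ρ : Vec (Q n) k) →
                          (∀ τ → (v ∷ ρ) ⊆ᵛ τ → y τ ≈ 0#) → signedInsert y v ρ ≈ 0#
  signedInsert-covering y v []      e = e (v ∷ []) id
  signedInsert-covering y v (u ∷ ρ) e with <Q-cmp v u
  ... | tri< _ _ _ = e (v ∷ u ∷ ρ) id
  ... | tri≈ _ _ _ = refl
  ... | tri> _ _ _ =
    trans (-‿cong (signedInsert-covering (y ∘ (u ∷_)) v ρ (λ τ v∷ρ⊆τ → e (u ∷ τ) (cover v∷ρ⊆τ)))) -0#≈0#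
    where
    cover : ∀ {k j} {ρ : Vec (Q _) k} {τ : Vec (Q _) j} → (v ∷ ρ) ⊆ᵛ τ → (v ∷ u ∷ ρ) ⊆ᵛ (u ∷ τ)
    cover v∷ρ⊆τ (here e)          = there (v∷ρ⊆τ (here e))
    cover v∷ρ⊆τ (there (here e))  = here e
    cover v∷ρ⊆τ (there (there m)) = there (v∷ρ⊆τ (there m))

  alternate-covering : ∀ {n} k (x : Vec (Q n) k → Carrier) σ → (∀ τ → σ ⊆ᵛ τ → x τ ≈ 0#) → alternate k x σ ≈ 0#
  alternate-covering zero    x []      e = e [] id
  alternate-covering (suc k) x (v ∷ σ) e =
    alternate-covering k (signedInsert x v) σ λ τ σ⊆τ →
      signedInsert-covering x v τ λ τ′ v∷τ⊆τ′ → e τ′ λ { (here e) → v∷τ⊆τ′ (here e) ; (there m) → v∷τ⊆τ′ (there (σ⊆τ m)) }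

  pushforward-chain : ∀ {a b} r k (h : Q a → Q b) → NonExpanding h → (x : Vec (Q a) k → Carrier) →
                      (∀ ρ → ¬ IsSimplex r ρ → x ρ ≈ 0#) → ∀ τ → ¬ IsSimplex r τ → pushforward k h x τ ≈ 0#
  pushforward-chain r k h h-ne x x-chain τ τ∉ with increasing? τ
  ... | no  _  = refl
  ... | yes τ↑ = ΣT-zero k term
    where
    term : ∀ σ → (if map h σ ==V τ then alternate k x σ else 0#) ≈ 0#
    term σ with map h σ ==V τ in hσ≡τ
    ... | false = refl
    ... | true  = alternate-covering k x σ λ ρ σ⊆ρ → x-chain ρ λ (_ , ρ-diam) →
      τ∉ (τ↑ , P.subst (DiamLe r) (==V-sound hσ≡τ) (DiamLe-map r h h-ne (DiamLe-⊆ r σ⊆ρ ρ-diam)))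

  pushforward-cycle : ∀ {a b} r q (h : Q a → Q b) → NonExpanding h → (z : Chain a q) → IsCycle r z →
                      IsCycle r (pushforward (suc q) h z)
  pushforward-cycle r zero    h h-ne z z-cyc = pushforward-chain r 1 h h-ne z z-cyc
  pushforward-cycle r (suc q) h h-ne z (z-chain , ∂z≈0) =
    pushforward-chain r (suc (suc q)) h h-ne z z-chain ,
    λ τ → trans (pushforward-∂ q h z (chain-supported r z z-chain) τ) (pushforward-zero (suc q) h ∂z≈0 τ)

  pushAll-embed : ∀ {n k j} (s : Subcube n k) (X : Vec (Q k) j → Carrier) (τ : Vec (Q n) j) →
                  pushAll (embed s) X τ ≈ (if allInSub s τ then X (map (project s) τ) else 0#)
  pushAll-embed {k = k} {j} s X τ = begin
    ΣT j (λ σ → if map (embed s) σ ==V τ then X σ else 0#)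
      ≈⟨ ΣT-cong j (λ σ → reflexive (P.trans (P.cong (λ b → if b then X σ else 0#) (==V-embed s σ τ))
                                             (if-∧ (allInSub s τ) (σ ==V map (project s) τ) _))) ⟩
    ΣT j (λ σ → if allInSub s τ then (if σ ==V map (project s) τ then X σ else 0#) else 0#)
      ≈⟨ sym (ΣT-if {n = k} j (allInSub s τ) _) ⟩
    (if allInSub s τ then ΣT j (λ σ → if σ ==V map (project s) τ then X σ else 0#) else 0#)
      ≈⟨ if-cong (allInSub s τ) (ΣT-δ j (map (project s) τ) X) ⟩
    (if allInSub s τ then X (map (project s) τ) else 0#) ∎

  push-pushforward : ∀ {n k} q (s : Subcube n k) (y : Chain k q) → SupportedOnIncreasing y →
                     ∀ τ → push s y τ ≈ pushforward (suc q) (embed s) y τ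
  push-pushforward q s y y↑ τ =
    trans restricted (sym (if-cong (does (increasing? τ)) (pushAll-embed s (alternate (suc q) y) τ)))
    where
    restricted : (if allInSub s τ then y (map (project s) τ) else 0#) ≈
                 (if does (increasing? τ) then (if allInSub s τ then alternate (suc q) y (map (project s) τ) else 0#) else 0#)
    restricted with allInSub s τ in τ∈s | increasing? τ
    ... | false | yes _   = refl
    ... | false | no  _   = refl
    ... | true  | yes τ↑ = sym (alternate-increasing (suc q) y _ (increasing-project s τ∈s τ↑))
    ... | true  | no ¬τ↑ = y↑ _ (λ sτ↑ → ¬τ↑ (P.subst Increasing (map-embed-project s τ τ∈s)
                                                        (increasing-map (embed s) (embed-mono s) sτ↑)))

  pushforward-push : ∀ {a n k} q (h : Q n → Q a) (s : Subcube n k) (y : Chain k q) → SupportedOnIncreasing y →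
                     ∀ τ → pushforward (suc q) h (push s y) τ ≈ pushforward (suc q) (h ∘ embed s) y τ
  pushforward-push q h s y y↑ τ =
    trans (pushforward-cong (suc q) h (push-pushforward q s y y↑) τ) (pushforward-∘ (suc q) h (embed s) y τ)

  pushforward-factor : ∀ {a b k} q (h : Q a → Q b) (u : Subcube b k) → (∀ y → inSub u (h y) ≡ true) →
                       (x : Chain a q) → ∀ τ → pushforward (suc q) h x τ ≈ push u (pushforward (suc q) (project u ∘ h) x) τ
  pushforward-factor q h u h∈u x τ = sym (begin
    push u (pushforward (suc q) (project u ∘ h) x) τ
      ≈⟨ push-pushforward q u _ (pushforward-supported (suc q) _ x) τ ⟩
    pushforward (suc q) (embed u) (pushforward (suc q) (project u ∘ h) x) τ
      ≈⟨ pushforward-∘ (suc q) (embed u) (project u ∘ h) x τ ⟩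
    pushforward (suc q) (embed u ∘ project u ∘ h) x τ
      ≈⟨ pushforward-cong-map (suc q) (λ y → embed-project u (h y) (h∈u y)) x τ ⟩
    pushforward (suc q) h x τ ∎)

  ∂-cong : ∀ {n q} {x y : Chain n (suc q)} → (∀ σ → x σ ≈ y σ) → ∀ σ → ∂ x σ ≈ ∂ y σ
  ∂-cong {n} {q} e σ = ΣL-cong (allQ n) (λ v → sumFin-cong {k = suc (suc q)} (λ j → *-congˡ {sgn j} (e (insertAt σ j v))))

  ∂-* : ∀ {n q} (d : Carrier) (y : Chain n (suc q)) → ∀ σ → ∂ (λ τ → d * y τ) σ ≈ d * ∂ y σ
  ∂-* {n} {q} d y σ = begin
    ΣL (allQ n) (λ v → sumFin (λ j → sgn j * (d * y (insertAt σ j v))))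
      ≈⟨ ΣL-cong (allQ n) (λ v → sumFin-cong {k = suc (suc q)} (λ j → *-x∙yz≈y∙xz (sgn j) d (y (insertAt σ j v)))) ⟩
    ΣL (allQ n) (λ v → sumFin (λ j → d * (sgn j * y (insertAt σ j v))))
      ≈⟨ ΣL-cong (allQ n) (λ v → sym (sumFin-* {k = suc (suc q)} d (λ j → sgn j * y (insertAt σ j v)))) ⟩
    ΣL (allQ n) (λ v → d * sumFin (λ j → sgn j * y (insertAt σ j v)))
      ≈⟨ sym (ΣL-* (allQ n) d _) ⟩
    d * ∂ y σ ∎

  cycle-chain : ∀ {n} r q {z : Chain n q} → IsCycle r z → IsChain r z
  cycle-chain r zero    z-cyc       = z-cyc
  cycle-chain r (suc q) (z-chain , _) = z-chain

  cycle-supported : ∀ {n} r q {z : Chain n q} → IsCycle r z → SupportedOnIncreasing z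
  cycle-supported r q {z} z-cyc = chain-supported r z (cycle-chain r q z-cyc)

  IsCycle-cong : ∀ {n} r q {x y : Chain n q} → (∀ σ → x σ ≈ y σ) → IsCycle r x → IsCycle r y
  IsCycle-cong r zero    e x-chain         = λ σ σ∉ → trans (sym (e σ)) (x-chain σ σ∉)
  IsCycle-cong r (suc q) e (x-chain , ∂x≈0) =
    (λ σ σ∉ → trans (sym (e σ)) (x-chain σ σ∉)) , (λ σ → trans (sym (∂-cong e σ)) (∂x≈0 σ))

  cycle-* : ∀ {n} r q (d : Carrier) {y : Chain n q} → IsCycle r y → IsCycle r (λ σ → d * y σ)
  cycle-* r zero    d y-chain         = λ σ σ∉ → trans (*-congˡ (y-chain σ σ∉)) (zeroʳ d)
  cycle-* r (suc q) d {y} (y-chain , ∂y≈0) =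
    (λ σ σ∉ → trans (*-congˡ (y-chain σ σ∉)) (zeroʳ d)) , (λ σ → trans (∂-* d y σ) (trans (*-congˡ (∂y≈0 σ)) (zeroʳ d)))

  push-cycle : ∀ {n k} r q (s : Subcube n k) {y : Chain k q} → IsCycle r y → IsCycle r (push s y)
  push-cycle r q s {y} y-cyc =
    IsCycle-cong r q (λ σ → sym (push-pushforward q s y (cycle-supported r q y-cyc) σ))
                 (pushforward-cycle r q (embed s) (embed-nonExpanding s) y y-cyc)

  -- Congruence modulo the image of Ψ

  sumPush-++ : ∀ {n k q} (ys ys' : List (Σ (Subcube n k) λ _ → Chain k q)) →
               ∀ σ → sumPush (ys ++ ys') σ ≈ sumPush ys σ + sumPush ys' σ
  sumPush-++ []             ys' σ = sym (+-identityˡ _)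
  sumPush-++ ((s , y) ∷ ys) ys' σ = trans (+-congˡ (sumPush-++ ys ys' σ)) (sym (+-assoc _ _ _))

  scaleCycle : ∀ {n k q} → Carrier → (Σ (Subcube n k) λ _ → Chain k q) → (Σ (Subcube n k) λ _ → Chain k q)
  scaleCycle d (s , y) = s , λ σ → d * y σ

  sumPush-scale : ∀ {n k q} (d : Carrier) (ys : List (Σ (Subcube n k) λ _ → Chain k q)) →
                  ∀ σ → sumPush (L.map (scaleCycle d) ys) σ ≈ d * sumPush ys σ
  sumPush-scale d []             σ = sym (zeroʳ d)
  sumPush-scale d ((s , y) ∷ ys) σ =
    trans (+-cong (sym (if-* (allInSub s σ) d _)) (sumPush-scale d ys σ)) (sym (distribˡ d _ _))

  CongruentModΨ : ∀ {n} (r q k : ℕ) → Chain n q → Chain n q → Set (c ⊔ ℓ)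
  CongruentModΨ {n} r q k x m = Σ (SubcubeCycles r q n k) λ ys → ∀ σ → x σ ≈ m σ + sumPush (proj₁ ys) σ

  modΨ-≈ : ∀ {n r q k} {x y : Chain n q} → (∀ σ → x σ ≈ y σ) → CongruentModΨ r q k x y
  modΨ-≈ x≈y = ([] , []) , λ σ → trans (x≈y σ) (sym (+-identityʳ _))

  modΨ-trans : ∀ {n r q k} {x y z : Chain n q} → CongruentModΨ r q k x y → CongruentModΨ r q k y z → CongruentModΨ r q k x z
  modΨ-trans {x = x} {y} {z} ((ys , ys-cyc) , x≈y+) ((ys' , ys'-cyc) , y≈z+) =
    (ys' ++ ys , All.++⁺ ys'-cyc ys-cyc) , λ σ → begin
      x σ                                    ≈⟨ x≈y+ σ ⟩
      y σ + sumPush ys σ                     ≈⟨ +-congʳ (y≈z+ σ) ⟩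
      (z σ + sumPush ys' σ) + sumPush ys σ   ≈⟨ +-assoc _ _ _ ⟩
      z σ + (sumPush ys' σ + sumPush ys σ)   ≈⟨ +-congˡ (sym (sumPush-++ ys' ys σ)) ⟩
      z σ + sumPush (ys' ++ ys) σ            ∎

  modΨ-sym : ∀ {n r q k} {x y : Chain n q} → CongruentModΨ r q k x y → CongruentModΨ r q k y x
  modΨ-sym {r = r} {q} {x = x} {y} ((ys , ys-cyc) , x≈y+) =
    (L.map (scaleCycle (- 1#)) ys , All.map⁺ (All.map (cycle-* r q (- 1#)) ys-cyc)) , λ σ → begin
      y σ                                        ≈⟨ sym (+-identityʳ _) ⟩
      y σ + 0#                                   ≈⟨ +-congˡ (sym (-‿inverseʳ _)) ⟩
      y σ + (sumPush ys σ + - sumPush ys σ)      ≈⟨ sym (+-assoc _ _ _) ⟩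
      (y σ + sumPush ys σ) + - sumPush ys σ      ≈⟨ +-cong (sym (x≈y+ σ)) (sym (-1*x≈-x _)) ⟩
      x σ + - 1# * sumPush ys σ                  ≈⟨ +-congˡ (sym (sumPush-scale (- 1#) ys σ)) ⟩
      x σ + sumPush (L.map (scaleCycle (- 1#)) ys) σ ∎

  modΨ-+ : ∀ {n r q k} {x x' m m' : Chain n q} → CongruentModΨ r q k x m → CongruentModΨ r q k x' m' →
           CongruentModΨ r q k (λ σ → x σ + x' σ) (λ σ → m σ + m' σ)
  modΨ-+ ((ys , ys-cyc) , x≈) ((ys' , ys'-cyc) , x'≈) =
    (ys ++ ys' , All.++⁺ ys-cyc ys'-cyc) ,
    λ σ → trans (+-cong (x≈ σ) (x'≈ σ)) (trans (interchange _ _ _ _) (+-congˡ (sym (sumPush-++ ys ys' σ))))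

  modΨ-* : ∀ {n r q k} (d : Carrier) {x m : Chain n q} → CongruentModΨ r q k x m →
           CongruentModΨ r q k (λ σ → d * x σ) (λ σ → d * m σ)
  modΨ-* {r = r} {q} d ((ys , ys-cyc) , x≈) =
    (L.map (scaleCycle d) ys , All.map⁺ (All.map (cycle-* r q d) ys-cyc)) ,
    λ σ → trans (*-congˡ (x≈ σ)) (trans (distribˡ d _ _) (+-congˡ (sym (sumPush-scale d ys σ))))

  modΨ-sumFin : ∀ {n r q k N} (f g : Fin N → Chain n q) → (∀ i → CongruentModΨ r q k (f i) (g i)) →
                CongruentModΨ r q k (λ σ → sumFin (λ i → f i σ)) (λ σ → sumFin (λ i → g i σ))
  modΨ-sumFin {N = zero}  f g f≡g = modΨ-≈ (λ _ → refl)
  modΨ-sumFin {N = suc N} f g f≡g = modΨ-+ (f≡g zero) (modΨ-sumFin (f ∘ suc) (g ∘ suc) (f≡g ∘ suc))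

  modΨ-push : ∀ {n k r q} (u : Subcube n k) {y : Chain k q} → IsCycle r y → CongruentModΨ r q k (push u y) (λ _ → 0#)
  modΨ-push u {y} y-cyc = ((u , y) ∷ [] , y-cyc ∷ []) , λ σ → sym (trans (+-identityˡ _) (+-identityʳ _))

  lincomb-modΨ : ∀ {n r q k N} (a : Fin N → Carrier) {z : Fin N → Chain n q} →
                 (∀ i → CongruentModΨ r q k (z i) (λ _ → 0#)) → CongruentModΨ r q k (lincomb a z) (λ _ → 0#)
  lincomb-modΨ a z≡0 =
    modΨ-trans (modΨ-sumFin _ _ (λ i → modΨ-* (a i) (z≡0 i))) (modΨ-≈ (λ σ → sumFin-zero (λ i → zeroʳ (a i))))

  pushforward-lincomb : ∀ {a b q N} (h : Q a → Q b) (w : Fin N → Carrier) (z : Fin N → Chain a q) →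
                        ∀ σ → pushforward (suc q) h (lincomb w z) σ ≈ lincomb w (pushforward (suc q) h ∘ z) σ
  pushforward-lincomb {N = zero}      h w z σ = pushforward-zero _ h (λ _ → refl) σ
  pushforward-lincomb {q = q} {suc N} h w z σ =
    trans (pushforward-+ (suc q) h _ _ σ)
          (+-cong (pushforward-* (suc q) h (w zero) (z zero) σ) (pushforward-lincomb h (w ∘ suc) (z ∘ suc) σ))

  pushforward-push-modΨ : ∀ {a b j k} r q (h : Q a → Q b) → NonExpanding h → (w : Subcube a j) →
                          MapsIntoSubcube k (h ∘ embed w) → {y : Chain j q} → IsCycle r y →
                          CongruentModΨ r q k (pushforward (suc q) h (push w y)) (λ _ → 0#)
  pushforward-push-modΨ r q h h-ne w (u , hw∈u) {y} y-cyc =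
    modΨ-trans (modΨ-≈ (λ σ → trans (pushforward-push q h w y (cycle-supported r q y-cyc) σ)
                                     (pushforward-factor q (h ∘ embed w) u hw∈u y σ)))
               (modΨ-push u (pushforward-cycle r q (project u ∘ h ∘ embed w)
                                (∘-nonExpanding {h = project u} {h ∘ embed w} (project-nonExpanding u)
                                                 (∘-nonExpanding {h = h} {embed w} h-ne (embed-nonExpanding w))) y y-cyc))

  pushforward-sumPush-modΨ : ∀ {a b k} r q (h : Q a → Q b) → NonExpanding h → PreservesSubcubes k h →
                             (ys : SubcubeCycles r q a k) → CongruentModΨ r q k (pushforward (suc q) h (sumPush (proj₁ ys))) (λ _ → 0#)
  pushforward-sumPush-modΨ r q h h-ne h-sub ([] , []) = modΨ-≈ (pushforward-zero (suc q) h (λ _ → refl))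
  pushforward-sumPush-modΨ r q h h-ne h-sub (((w , y) ∷ ys) , (y-cyc ∷ ys-cyc)) =
    modΨ-trans (modΨ-≈ (pushforward-+ (suc q) h _ _))
               (modΨ-trans (modΨ-+ (pushforward-push-modΨ r q h h-ne w (h-sub w) y-cyc)
                                   (pushforward-sumPush-modΨ r q h h-ne h-sub (ys , ys-cyc)))
                           (modΨ-≈ (λ _ → +-identityʳ 0#)))

  pushforward-zeroInQuot : ∀ {a b} r q k (h : Q a → Q b) → NonExpanding h → PreservesSubcubes k h →
                           {x : Chain a q} {m : Chain b q} → ZeroInQuot r k x →
                           CongruentModΨ r q k (pushforward (suc q) h x) m → ZeroInQuot r k m
  pushforward-zeroInQuot r q k h h-ne h-sub {x} (B , B-chain , ys , x≈) hx≡m =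
    pushforward (suc (suc q)) h B , pushforward-chain r (suc (suc q)) h h-ne B B-chain , proj₁ m≡∂B , proj₂ m≡∂B
    where
    hx≡∂hB : CongruentModΨ r q k (pushforward (suc q) h x) (∂ (pushforward (suc (suc q)) h B))
    hx≡∂hB = modΨ-trans (modΨ-≈ (λ σ → trans (pushforward-cong (suc q) h x≈ σ) (pushforward-+ (suc q) h _ _ σ)))
               (modΨ-trans (modΨ-+ (modΨ-≈ (λ σ → sym (pushforward-∂ q h B (chain-supported r B B-chain) σ)))
                                    (pushforward-sumPush-modΨ r q h h-ne h-sub ys))
                           (modΨ-≈ (λ _ → +-identityʳ _)))
    m≡∂B = modΨ-trans (modΨ-sym hx≡m) hx≡∂hB

  -- Independence of the lifted cycles

  lincomb-++ : ∀ {n q M N a} {A : Set a} (w : Fin (M ℕ.+ N) → Carrier) (F : A → Chain n q) (f : Fin M → A) (g : Fin N → A) →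
               ∀ σ → lincomb w (F ∘ (f ++ᶠ g)) σ ≈ lincomb (w ∘ (_↑ˡ N)) (F ∘ f) σ + lincomb (w ∘ (M ↑ʳ_)) (F ∘ g) σ
  lincomb-++ {M = M} {N} w F f g σ =
    trans (sumFin-splitAt M _)
          (+-cong (sumFin-cong (λ i → reflexive (P.cong (λ x → w (i ↑ˡ N) * F x σ) (lookup-++ˡ f g i))))
                  (sumFin-cong (λ j → reflexive (P.cong (λ x → w (M ↑ʳ j) * F x σ) (lookup-++ʳ f g j)))))

  testMap-push-free : ∀ {n k} q (t : Subcube n k) (y : Chain (suc k) q) → SupportedOnIncreasing y →
                      ∀ σ → pushforward (suc q) (testMap t) (push (free t) y) σ ≈ y σ
  testMap-push-free q t y y↑ σ =
    trans (pushforward-push q (testMap t) (free t) y y↑ σ)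
          (trans (pushforward-cong-map (suc q) (testMap-retracts t) y σ) (pushforward-id (suc q) y y↑ σ))

  tail-push-bottomFace : ∀ {n} q (y : Chain n q) → SupportedOnIncreasing y →
                         ∀ σ → pushforward (suc q) tail (push (bottomFace n) y) σ ≈ y σ
  tail-push-bottomFace q y y↑ σ =
    trans (pushforward-push q tail (bottomFace _) y y↑ σ)
          (trans (pushforward-cong-map (suc q) embed-allFree y σ) (pushforward-id (suc q) y y↑ σ))

  module LiftedCycles {r q k R} {z : Fin R → Chain (suc k) q} (z-cyc : ∀ j → IsCycle r (z j)) where

    liftCycles : ∀ {n} (L : List (Subcube n k)) → Fin (length L ℕ.* R) → Chain (suc n) q
    liftCycles []      ()
    liftCycles (t ∷ L) = (push (free t) ∘ z) ++ᶠ liftCycles L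

    liftCycles-cycle : ∀ {n} (L : List (Subcube n k)) i → IsCycle r (liftCycles L i)
    liftCycles-cycle []      ()
    liftCycles-cycle (t ∷ L) = ++ᶠ-∀ {P = IsCycle r} (λ j → push-cycle r q (free t) (z-cyc j)) (liftCycles-cycle L)

    liftIndex : ∀ {n} (L : List (Subcube n k)) {t} → t ∈ L → Fin R → Fin (length L ℕ.* R)
    liftIndex (_ ∷ L) (here _)  j = j ↑ˡ (length L ℕ.* R)
    liftIndex (_ ∷ L) (there p) j = R ↑ʳ liftIndex L p j

    liftIndex-elim : ∀ {n p} (L : List (Subcube n k)) {P : Fin (length L ℕ.* R) → Set p} →
                     (∀ {t} (t∈L : t ∈ L) j → P (liftIndex L t∈L j)) → ∀ i → P i
    liftIndex-elim []      f ()
    liftIndex-elim (t ∷ L) f = Fin-+-elim R (f (here P.refl)) (liftIndex-elim L (f ∘ there))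

    block-modΨ : ∀ {n a} (h : Q (suc n) → Q a) → NonExpanding h → (t : Subcube n k) →
                 MapsIntoSubcube k (h ∘ embed (free t)) → (b : Fin R → Carrier) →
                 CongruentModΨ r q k (lincomb b (pushforward (suc q) h ∘ push (free t) ∘ z)) (λ _ → 0#)
    block-modΨ h h-ne t h∘t b = lincomb-modΨ b (λ j → pushforward-push-modΨ r q h h-ne (free t) h∘t (z-cyc j))

    liftCycles-modΨ : ∀ {n a} (h : Q (suc n) → Q a) → NonExpanding h → (L : List (Subcube n k)) →
                      All (λ t → MapsIntoSubcube k (h ∘ embed (free t))) L → (b : Fin (length L ℕ.* R) → Carrier) →
                      CongruentModΨ r q k (lincomb b (pushforward (suc q) h ∘ liftCycles L)) (λ _ → 0#)
    liftCycles-modΨ h h-ne []      []              b = modΨ-≈ (λ _ → refl)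
    liftCycles-modΨ h h-ne (t ∷ L) (h∘t ∷ h∘L) b =
      modΨ-trans (modΨ-≈ (lincomb-++ b (pushforward (suc q) h) (push (free t) ∘ z) (liftCycles L)))
                 (modΨ-trans (modΨ-+ (block-modΨ h h-ne t h∘t _) (liftCycles-modΨ h h-ne L h∘L _))
                             (modΨ-≈ (λ _ → +-identityʳ 0#)))

    -- The test map of t ∈ L picks out the block of t and kills all others.
    testMap-liftCycles : ∀ {n} (t : Subcube n k) (L : List (Subcube n k)) → Unique L → (t∈L : t ∈ L) →
                         (b : Fin (length L ℕ.* R) → Carrier) →
                         CongruentModΨ r q k (lincomb b (pushforward (suc q) (testMap t) ∘ liftCycles L))
                                             (lincomb (b ∘ liftIndex L t∈L) z)
    testMap-liftCycles t (t ∷ L) (t∉L ∷ _) (here P.refl) b =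
      modΨ-trans (modΨ-≈ (lincomb-++ b (pushforward (suc q) (testMap t)) (push (free t) ∘ z) (liftCycles L)))
                 (modΨ-trans (modΨ-+ (modΨ-≈ (λ σ → sumFin-cong (λ j →
                                        *-congˡ (testMap-push-free q t (z j) (cycle-supported r q (z-cyc j)) σ))))
                                     (liftCycles-modΨ (testMap t) (testMap-nonExpanding t) L
                                        (All.map (λ {t′} t≢t′ → testMap-free t t′ t≢t′) t∉L) _))
                             (modΨ-≈ (λ _ → +-identityʳ _)))
    testMap-liftCycles t (t′ ∷ L) (t′∉L ∷ L-unique) (there t∈L) b =
      modΨ-trans (modΨ-≈ (lincomb-++ b (pushforward (suc q) (testMap t)) (push (free t′) ∘ z) (liftCycles L)))
                 (modΨ-trans (modΨ-+ (block-modΨ (testMap t) (testMap-nonExpanding t) t′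
                                        (testMap-free t t′ (All.lookup t′∉L t∈L ∘ P.sym)) _)
                                     (testMap-liftCycles t L L-unique t∈L _))
                             (modΨ-≈ (λ _ → +-identityˡ _)))

    module Extension {n N} (c : Fin N → Chain n q) (c-cyc : ∀ l → IsCycle r (c l)) where
      L = allSub n k
      M = length L ℕ.* R

      old : Fin N → Chain (suc n) q
      old = push (bottomFace n) ∘ c

      Z : Fin (M ℕ.+ N) → Chain (suc n) q
      Z = liftCycles L ++ᶠ old

      Z-cyc : ∀ i → IsCycle r (Z i)
      Z-cyc = ++ᶠ-∀ {P = IsCycle r} (liftCycles-cycle L) (λ l → push-cycle r q (bottomFace n) (c-cyc l))

      pushforward-lincomb-Z : ∀ {a} (h : Q (suc n) → Q a) (w : Fin (M ℕ.+ N) → Carrier) → ∀ σ →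
                              pushforward (suc q) h (lincomb w Z) σ ≈
                              lincomb (w ∘ (_↑ˡ N)) (pushforward (suc q) h ∘ liftCycles L) σ +
                              lincomb (w ∘ (M ↑ʳ_)) (pushforward (suc q) h ∘ old) σ
      pushforward-lincomb-Z h w σ =
        trans (pushforward-lincomb h w Z σ) (lincomb-++ w (pushforward (suc q) h) (liftCycles L) old σ)

      testMap-lincomb-Z : ∀ (w : Fin (M ℕ.+ N) → Carrier) {t} (t∈L : t ∈ L) →
                          CongruentModΨ r q k (pushforward (suc q) (testMap t) (lincomb w Z))
                                              (lincomb (λ j → w (liftIndex L t∈L j ↑ˡ N)) z)
      testMap-lincomb-Z w {t} t∈L =
        modΨ-trans (modΨ-≈ (pushforward-lincomb-Z (testMap t) w))
          (modΨ-trans (modΨ-+ (testMap-liftCycles t L (allSub-unique n k) t∈L _)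
                              (lincomb-modΨ _ (λ l → pushforward-push-modΨ r q (testMap t) (testMap-nonExpanding t)
                                                       (bottomFace n) (testMap-bottomFace t) (c-cyc l))))
                      (modΨ-≈ (λ _ → +-identityʳ _)))

      tail-lincomb-Z : ∀ (w : Fin (M ℕ.+ N) → Carrier) →
                       CongruentModΨ r q k (pushforward (suc q) tail (lincomb w Z)) (lincomb (w ∘ (M ↑ʳ_)) c)
      tail-lincomb-Z w =
        modΨ-trans (modΨ-≈ (pushforward-lincomb-Z tail w))
          (modΨ-trans (modΨ-+ (liftCycles-modΨ tail tail-nonExpanding L (All.tabulate (λ {t} _ → tail-free t)) _)
                              (modΨ-≈ (λ σ → sumFin-cong (λ l →
                                 *-congˡ (tail-push-bottomFace q (c l) (cycle-supported r q (c-cyc l)) σ)))))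
                      (modΨ-≈ (λ _ → +-identityˡ _)))

    step : ∀ {n N} → k ≤ n → (∀ a → ZeroInQuot r k (lincomb a z) → ∀ j → a j ≈ 0#) →
           RankAtLeast r q n k N → RankAtLeast r q (suc n) k (length (allSub n k) ℕ.* R ℕ.+ N)
    step {n} k≤n z-ind (c , c-cyc , c-ind) = Z , Z-cyc , λ w w-zero →
      Fin-+-elim M
        (liftIndex-elim L λ {t} t∈L → z-ind _
          (pushforward-zeroInQuot r q k (testMap t) (testMap-nonExpanding t) (testMap-preservesSubcubes t)
                                  w-zero (testMap-lincomb-Z w t∈L)))
        (c-ind _ (pushforward-zeroInQuot r q k tail tail-nonExpanding (tail-preservesSubcubes k≤n)
                                         w-zero (tail-lincomb-Z w)))
      where open Extension c c-cyc

  rank-lower-bound : ∀ {r q k R} → RankAtLeast r q (suc k) k R → ∀ n → k ≤ n →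
                     RankAtLeast r q n k (sumFrom (suc k) n (λ i → 2 ^ (i ∸ suc k) ℕ.* ((i ∸ 1) C k)) ℕ.* R)
  rank-lower-bound {r} {q} {k} {R} (z , z-cyc , z-ind) n k≤n with ℕP.m≤n⇒m<n∨m≡n k≤n
  ... | inj₂ P.refl rewrite sumFrom-empty k (λ i → 2 ^ (i ∸ suc k) ℕ.* ((i ∸ 1) C k)) = (λ ()) , (λ ()) , (λ _ _ ())
  rank-lower-bound {r} {q} {k} {R} (z , z-cyc , z-ind) (suc n) _ | inj₁ (s≤s k≤n) =
    P.subst (RankAtLeast r q (suc n) k) (P.sym count)
            (LiftedCycles.step z-cyc k≤n z-ind (rank-lower-bound (z , z-cyc , z-ind) n k≤n))
    where
    f = λ i → 2 ^ (i ∸ suc k) ℕ.* ((i ∸ 1) C k)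
    count : sumFrom (suc k) (suc n) f ℕ.* R ≡ length (allSub n k) ℕ.* R ℕ.+ sumFrom (suc k) n f ℕ.* R
    count = P.trans (P.cong (ℕ._* R) (sumFrom-last k n f k≤n))
                    (P.trans (ℕP.*-distribʳ-+ R (f (suc n)) _)
                             (P.cong (λ l → l ℕ.* R ℕ.+ sumFrom (suc k) n f ℕ.* R) (P.sym (length-allSub n k))))

  theorem : Theorem
  theorem r q p _ _ 1≤p _ _ zero    n p≤m _   _  _         = ⊥-elim (ℕP.<⇒≱ (ℕP.≤-trans 1≤p p≤m) z≤n)
  theorem r q p _ _ _   _ _ (suc k) n _   m≤n Rm (rank , _) = rank-lower-bound rank n (ℕP.≤-trans (ℕP.n≤1+n k) m≤n)

mainTheorem3 : BothCases +-*-commutativeRing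
mainTheorem3 = record
  { fieldCoefficients   = λ F _ → WithCoefficients.theorem F
  ; integerCoefficients = WithCoefficients.theorem +-*-commutativeRing
  }
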